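{- Let $X=\{a_1,\dots,a_{3n}\}$ be a set of distinct natural numbers with $\sum_{i=1}^{3n}a_i=nB$ and $B/4<a_i<B/2$ for all $i$, let $m=\max X$, and let $G_p$ be the graph constructed from $X$ as described in the context. If $b(G_p)=2m+1$, then $X$ can be partitioned into $n$ triples each of which sums to $B$.
   Context: Burning: for a finite simple graph $G$, a burning sequence is a sequence $(b_1,\dots,b_k)$ of vertices such that every vertex $v$ satisfies $d_G(v,b_i)\le k-i$ for some $i$; $b(G)$ is the minimum length of a burning sequence. Construction of $G_p$ from $X$: let $k=m-3n$, $X'=\{2a_i-1: a_i\in X\}$, $B'=\frac{1}{n}\sum_{x\in X'}x$, $Z=\{1,3,5,\dots,2m-1\}$ (the first $m$ odd naturals), and $Y=Z\setminus X'$, so $|Y|=k$; let $y_i$ be the $i$-th largest element of $Y$. Take paths $S_1,\dots,S_n$ each on $B'$ vertices, paths $S'_1,\dots,S'_k$ with $S'_i$ on $y_i$ vertices, and paths $Q_1,\dots,Q_{m+1}$ with $Q_j$ on $2(2m+1-j)+1$ vertices. Concatenate them (joining the last vertex of each path by an edge to the first vertex of the next) in the order $S_1,Q_1,S_2,Q_2,\dots,S_n,Q_n,S'_1,Q_{n+1},S'_2,Q_{n+2},\dots,S'_k,Q_{n+k},Q_{n+k+1},\dots,Q_{m+1}$, giving a path $P$ on $(2m+1)^2$ vertices. Then for each $Q_i$ with vertices $w_1,\dots,w_{s}$ in path order ($s=|V(Q_i)|$), add $s-1$ new vertices $q_{i1},\dots,q_{i(s-1)}$ where $q_{ix}$ is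 adjacent exactly to $w_x$ and $w_{x+1}$. The resulting graph is $G_p$ (a connected proper interval graph). -}

module Defs where

open import Data.Nat using (ℕ; zero; suc; _+_; _*_; _∸_; _⊔_; _≤_; NonZero)
open import Data.Nat.DivMod using (_/_)
open import Data.Nat.Properties using (_≟_)
open import Data.Bool using (Bool; true; false)
open import Data.Fin using (Fin; toℕ)
open import Data.Vec using (Vec; lookup)
open import Data.List using (List; []; _∷_; _++_; map; concat; concatMap; zip; upTo; downFrom; filter; foldr; length)
open import Data.Nat.ListAction using (sum)
open import Data.List.Membership.Propositional using (_∈_)
open import Data.List.Membership.DecPropositional _≟_ using (_∉?_)
open import Data.Product using (Σ; _×_; _,_; ∃)
open import Data.Sum using (_⊎_)

record Graph : Set where
  field
    N : ℕ
    E : List (ℕ × ℕ)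

open Graph public

Adj : (G : Graph) → Fin (N G) → Fin (N G) → Set
Adj G u v = ((toℕ u , toℕ v) ∈ E G) ⊎ ((toℕ v , toℕ u) ∈ E G)

data Within (G : Graph) : ℕ → Fin (N G) → Fin (N G) → Set where
  here : ∀ {r u} → Within G r u u
  step : ∀ {r u v w} → Adj G u v → Within G r v w → Within G (suc r) u w

-- (b_1,...,b_k) (stored 0-indexed) is a burning sequence: every vertex v
-- has some i with d(v , b_i) ≤ k - i (1-indexed), i.e. k - 1 - i 0-indexed.
IsBurningSequence : (G : Graph) (k : ℕ) → Vec (Fin (N G)) k → Set
IsBurningSequence G k bs =
  (v : Fin (N G)) → Σ (Fin k) λ i → Within G (k ∸ suc (toℕ i)) v (lookup bs i)

BurningNumberIs : Graph → ℕ → Set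
BurningNumberIs G k =
  Σ (Vec (Fin (N G)) k) (IsBurningSequence G k)
  × ((j : ℕ) (bs : Vec (Fin (N G)) j) → IsBurningSequence G j bs → k ≤ j)

maxList : List ℕ → ℕ
maxList = foldr _⊔_ 0

range : ℕ → ℕ → List ℕ
range a b = map (a +_) (upTo (b ∸ a))

-- |V(Q_j)| = 2(2m+1-j)+1
qlen : ℕ → ℕ → ℕ
qlen m j = 2 * (2 * m + 1 ∸ j) + 1

-- B' = (1/n) Σ_{x ∈ X'} x,  X' = {2a-1 : a ∈ X}
B′ : (n : ℕ) → .{{NonZero n}} → List ℕ → ℕ
B′ n X = sum (map (λ a → 2 * a ∸ 1) X) / n

-- Y = Z \ X' listed in decreasing order (y_1 > y_2 > ...);
-- 2j-1 ∈ X' iff j ∈ X.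
Ylist : List ℕ → List ℕ
Ylist X = map (λ j → 2 * suc j ∸ 1) (filter (λ j → suc j ∉? X) (downFrom (maxList X)))

-- The segments of P, in order, as (number of vertices , is-a-Q-path)
segments : (n : ℕ) → .{{NonZero n}} → List ℕ → List (ℕ × Bool)
segments n X =
  concatMap (λ i → (B′ n X , false) ∷ (qlen m i , true) ∷ []) (range 1 (suc n))
  ++ concatMap (λ p → (Data.Product.proj₁ p , false) ∷ (qlen m (n + suc (Data.Product.proj₂ p)) , true) ∷ [])
               (zip (Ylist X) (upTo (length (Ylist X))))
  ++ map (λ j → (qlen m j , true)) (range (n + k + 1) (m + 2))
  where
    m = maxList X
    k = m ∸ 3 * n

pathLen : List (ℕ × Bool) → ℕ
pathLen ss = sum (map Data.Product.proj₁ ss)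

-- number of added vertices q_{ix}
extraLen : List (ℕ × Bool) → ℕ
extraLen [] = 0
extraLen ((s , false) ∷ ss) = extraLen ss
extraLen ((s , true) ∷ ss) = (s ∸ 1) + extraLen ss

-- edges of the added vertices; o = index of first vertex of the current
-- segment on P, e = index of the next unused added vertex.
extraEdges : ℕ → ℕ → List (ℕ × Bool) → List (ℕ × ℕ)
extraEdges o e [] = []
extraEdges o e ((s , false) ∷ ss) = extraEdges (o + s) e ss
extraEdges o e ((s , true) ∷ ss) =
  concatMap (λ x → (e + x , o + x) ∷ (e + x , o + suc x) ∷ []) (upTo (s ∸ 1))
  ++ extraEdges (o + s) (e + (s ∸ 1)) ss

graphOf : List (ℕ × Bool) → Graph
graphOf ss = record
  { N = pathLen ss + extraLen ss
  ; E = map (λ i → (i , suc i)) (upTo (pathLen ss ∸ 1))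
        ++ extraEdges 0 (pathLen ss) ss
  }

Gp : (n : ℕ) → .{{NonZero n}} → List ℕ → Graph
Gp n X = graphOf (segments n X)

module Submission where

-- Give the path vertex p of G_p the height 2p and the vertex added between p and p + 1 the
-- height 2p + 1.  Adjacent vertices differ in height by at most 2, so a burning sequence of
-- length K = 2m + 1 yields K intervals of radii K - 1, ..., 0 covering the K² vertices of P;
-- since Σ_{r<K} (2r + 1) = K², they partition P.  The added vertices keep each Q-path inside one
-- interval, and by induction the interval of radius K - 1 - e is exactly Q_{e+1}.  The other
-- intervals, of lengths 2a - 1 for a ≤ m, tile the S- and S′-paths; by induction on length each
-- S′-path is a single interval with a ∉ X, so each S-path (of 2B - 3 vertices) is tiled by intervals
-- with a ∈ X, and B/4 < a < B/2 leaves room for exactly three, whose values a sum to B.  The radii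
-- are distinct, so the n triples use 3n distinct elements of X, that is, all of X.

open import Defs
open import Data.Nat
open import Data.Nat.Properties
open import Data.Nat.DivMod using (_/_; _%_; m≡m%n+[m/n]*n; m%n<n; m*n/n≡m)
open import Data.Nat.Induction using (<-rec)
open import Data.Nat.Tactic.RingSolver using (solve-∀)
open import Data.Nat.ListAction using (sum)
open import Data.Nat.ListAction.Properties using (sum-↭; sum-++)
open import Data.Bool using (Bool; true; false)
open import Data.Fin using (Fin; toℕ; fromℕ<; punchOut)
open import Data.Fin.Properties using (toℕ<n; toℕ-fromℕ<; toℕ-injective; any?; punchOut-injective; pigeonhole)
  renaming (_≟_ to _≟ᶠ_; <⇒≢ to <⇒≢ᶠ)
open import Data.Vec using (Vec; lookup)
open import Data.List using (List; []; _∷_; [_]; _++_; map; concatMap; upTo; applyUpTo; downFrom; filter; zip; length)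
open import Data.List.Properties
  using (length-++; length-map; length-downFrom; map-∘; map-++; map-upTo; concatMap-++; concatMap-map; concatMap-pure;
         ++-assoc; ++-identityʳ)
open import Data.List.Membership.Propositional using (_∈_; _∉_; find)
open import Data.List.Membership.Propositional.Properties
  using (∈-++⁻; ∈-++⁺ˡ; ∈-++⁺ʳ; ∈-∃++; ∈-map⁻; ∈-map⁺; ∈-upTo⁻; ∈-concatMap⁻; ∈-filter⁻; ∈-filter⁺;
         ∈-downFrom⁻; ∈-downFrom⁺)
open import Data.List.Membership.Propositional.Properties.WithK using (unique∧set⇒bag)
open import Data.List.Membership.DecPropositional _≟_ using (_∈?_)
open import Data.List.Relation.Unary.Any using (here; there)
open import Data.List.Relation.Unary.All using (All)
import Data.List.Relation.Unary.All as All
import Data.List.Relation.Unary.All.Properties as All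
open import Data.List.Relation.Unary.AllPairs using (AllPairs)
import Data.List.Relation.Unary.AllPairs as AllPairs
import Data.List.Relation.Unary.AllPairs.Properties as AllPairs
open import Data.List.Relation.Unary.Unique.Propositional using (Unique; _∷_)
import Data.List.Relation.Unary.Unique.Propositional.Properties as Unique
open import Data.List.Relation.Binary.BagAndSetEquality using (∼bag⇒↭)
open import Data.List.Relation.Binary.Permutation.Propositional using (_↭_; ↭-refl; ↭-prep; ↭-trans)
import Data.List.Relation.Binary.Permutation.Propositional.Properties as ↭
open import Data.Product using (Σ; ∃; ∃₂; _×_; _,_; proj₁; proj₂; swap)
open import Data.Sum using (_⊎_; inj₁; inj₂)
open import Data.Empty using (⊥; ⊥-elim)
open import Function.Bundles using (mk⇔)
open import Relation.Nullary using (Dec; yes; no)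
import Relation.Unary as U
open import Relation.Unary.Properties using (∁?)
open import Relation.Binary.Definitions using (DecidableEquality; tri<; tri≈; tri>)
open import Relation.Binary.PropositionalEquality hiding ([_])

Near : ℕ → ℕ → ℕ → Set
Near r x y = x ≤ y + r × y ≤ x + r

Near-refl : ∀ r x → Near r x x
Near-refl r x = m≤m+n x r , m≤m+n x r

Near-sym : ∀ {r x y} → Near r x y → Near r y x
Near-sym = swap

Near-trans : ∀ {r s x y z} → Near r x y → Near s y z → Near (r + s) x z
Near-trans {r} {s} {x} {y} {z} (x≤y+r , y≤x+r) (y≤z+s , z≤y+s) =
  ≤-trans x≤y+r (≤-trans (+-monoˡ-≤ r y≤z+s) (≤-reflexive (trans (+-assoc z s r) (cong (z +_) (+-comm s r))))) ,
  ≤-trans z≤y+s (≤-trans (+-monoˡ-≤ s y≤x+r) (≤-reflexive (+-assoc x r s)))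

Near-mono : ∀ {r s x y} → r ≤ s → Near r x y → Near s x y
Near-mono r≤s (x≤ , y≤) = ≤-trans x≤ (+-monoʳ-≤ _ r≤s) , ≤-trans y≤ (+-monoʳ-≤ _ r≤s)

2*m≤2*n+1⇒m≤n : ∀ {m n} → 2 * m ≤ 2 * n + 1 → m ≤ n
2*m≤2*n+1⇒m≤n {m} {n} h with m ≤? n
... | yes m≤n = m≤n
... | no m≰n = ⊥-elim (<⇒≱ (≤-trans (≤-reflexive (eq n)) (*-monoʳ-≤ 2 (≰⇒> m≰n))) h)
  where eq : ∀ n → suc (2 * n + 1) ≡ 2 * suc n
        eq = solve-∀

2*m+1≤2*n⇒m<n : ∀ {m n} → 2 * m + 1 ≤ 2 * n → m < n
2*m+1≤2*n⇒m<n {m} {n} h = 2*m≤2*n+1⇒m≤n (≤-trans (≤-reflexive (eq m)) (+-monoˡ-≤ 1 h))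
  where eq : ∀ m → 2 * suc m ≡ 2 * m + 1 + 1
        eq = solve-∀

Near-double : ∀ {r x y} → Near (2 * r) (2 * x) (2 * y) → Near r x y
Near-double {r} {x} {y} (a , b) =
  *-cancelˡ-≤ 2 (≤-trans a (≤-reflexive (sym (*-distribˡ-+ 2 y r)))) ,
  *-cancelˡ-≤ 2 (≤-trans b (≤-reflexive (sym (*-distribˡ-+ 2 x r))))

Near-odd-double : ∀ {r x y} → Near (2 * r) (2 * x + 1) (2 * y) → Near r x y × Near r (suc x) y
Near-odd-double {r} {x} {y} (a , b) = (<⇒≤ x<y+r , y≤x+r) , (x<y+r , ≤-trans y≤x+r (n≤1+n _))
  where
    y≤x+r : y ≤ x + r
    y≤x+r = 2*m≤2*n+1⇒m≤n (≤-trans b (≤-reflexive (eq x r)))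
      where eq : ∀ x r → 2 * x + 1 + 2 * r ≡ 2 * (x + r) + 1
            eq = solve-∀
    x<y+r : x < y + r
    x<y+r = 2*m+1≤2*n⇒m<n (≤-trans a (≤-reflexive (sym (*-distribˡ-+ 2 y r))))

square+offset<square : ∀ {r r′ d d′} → d ≤ 2 * r → r < r′ → r * r + d < r′ * r′ + d′
square+offset<square {r} {r′} {d} {d′} d≤2r r<r′ = begin-strict
  r * r + d          ≤⟨ +-monoʳ-≤ (r * r) d≤2r ⟩
  r * r + 2 * r      <⟨ n<1+n _ ⟩
  suc (r * r + 2 * r) ≡⟨ eq r ⟩
  suc r * suc r      ≤⟨ *-mono-≤ r<r′ r<r′ ⟩
  r′ * r′            ≤⟨ m≤m+n _ d′ ⟩
  r′ * r′ + d′       ∎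
  where open ≤-Reasoning
        eq : ∀ r → suc (r * r + 2 * r) ≡ suc r * suc r
        eq = solve-∀

square+offset-injective : ∀ {r r′ d d′} → d ≤ 2 * r → d′ ≤ 2 * r′ → r * r + d ≡ r′ * r′ + d′ → r ≡ r′
square+offset-injective {r} {r′} d≤ d′≤ eq with <-cmp r r′
... | tri< r<r′ _ _ = ⊥-elim (<⇒≢ (square+offset<square d≤ r<r′) eq)
... | tri≈ _ r≡r′ _ = r≡r′
... | tri> _ _ r′<r = ⊥-elim (<⇒≢ (square+offset<square d′≤ r′<r) (sym eq))

m≡2*[m/2]+m%2 : ∀ g → g ≡ 2 * (g / 2) + g % 2
m≡2*[m/2]+m%2 g = trans (m≡m%n+[m/n]*n g 2) (trans (+-comm (g % 2) _) (cong (_+ g % 2) (*-comm (g / 2) 2)))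

m%2≡0⊎m%2≡1 : ∀ g → g % 2 ≡ 0 ⊎ g % 2 ≡ 1
m%2≡0⊎m%2≡1 g with g % 2 | m%n<n g 2
... | 0 | _ = inj₁ refl
... | 1 | _ = inj₂ refl
... | suc (suc _) | s≤s (s≤s ())

-- g / 2 + g % 2 is ⌈g/2⌉: the points p with |2p - g| ≤ 2r are those of [⌈g/2⌉ - r, ⌊g/2⌋ + r].
Near-double-bounds : ∀ {r p g} → Near (2 * r) (2 * p) g → g / 2 + g % 2 ≤ p + r × p + r ≤ g / 2 + 2 * r
Near-double-bounds {r} {p} {g} (2p≤ , g≤) = lower (m%2≡0⊎m%2≡1 g) , upper
  where
    h = g / 2
    g≤2[p+r] : 2 * h + g % 2 ≤ 2 * (p + r)
    g≤2[p+r] = ≤-trans (≤-reflexive (sym (m≡2*[m/2]+m%2 g))) (≤-trans g≤ (≤-reflexive (sym (*-distribˡ-+ 2 p r))))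
    lower : g % 2 ≡ 0 ⊎ g % 2 ≡ 1 → h + g % 2 ≤ p + r
    lower (inj₁ even) rewrite even | +-identityʳ h =
      *-cancelˡ-≤ 2 (subst (_≤ 2 * (p + r)) (trans (cong (2 * h +_) even) (+-identityʳ (2 * h))) g≤2[p+r])
    lower (inj₂ odd) rewrite odd =
      ≤-trans (≤-reflexive (+-comm h 1)) (2*m+1≤2*n⇒m<n (subst (λ b → 2 * h + b ≤ 2 * (p + r)) odd g≤2[p+r]))
    upper : p + r ≤ h + 2 * r
    upper = ≤-trans (+-monoˡ-≤ r p≤h+r) (≤-reflexive (eq h r))
      where
        p≤h+r : p ≤ h + r
        p≤h+r = 2*m≤2*n+1⇒m≤n (begin
          2 * p                      ≤⟨ 2p≤ ⟩
          g + 2 * r                  ≡⟨ cong (_+ 2 * r) (m≡2*[m/2]+m%2 g) ⟩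
          2 * h + g % 2 + 2 * r      ≤⟨ +-monoˡ-≤ (2 * r) (+-monoʳ-≤ (2 * h) (≤-pred (m%n<n g 2))) ⟩
          2 * h + 1 + 2 * r          ≡⟨ eq′ h r ⟩
          2 * (h + r) + 1            ∎)
          where open ≤-Reasoning
                eq′ : ∀ h r → 2 * h + 1 + 2 * r ≡ 2 * (h + r) + 1
                eq′ = solve-∀
        eq : ∀ h r → h + r + r ≡ h + 2 * r
        eq = solve-∀

Σ< : ℕ → (ℕ → ℕ) → ℕ
Σ< zero f = 0
Σ< (suc c) f = f 0 + Σ< c (λ i → f (suc i))

Σ<-+ : ∀ a c f → Σ< (a + c) f ≡ Σ< a f + Σ< c (λ i → f (a + i))
Σ<-+ zero c f = refl
Σ<-+ (suc a) c f = trans (cong (f 0 +_) (Σ<-+ a c (λ i → f (suc i)))) (sym (+-assoc (f 0) _ _))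

Σ<-snoc : ∀ c f → Σ< (suc c) f ≡ Σ< c f + f c
Σ<-snoc c f = trans (cong (λ x → Σ< x f) (+-comm 1 c))
                (trans (Σ<-+ c 1 f) (cong (Σ< c f +_) (trans (+-identityʳ (f (c + 0))) (cong f (+-identityʳ c)))))

Σ<-cong : ∀ c {f g} → (∀ i → i < c → f i ≡ g i) → Σ< c f ≡ Σ< c g
Σ<-cong zero f≗g = refl
Σ<-cong (suc c) f≗g = cong₂ _+_ (f≗g 0 z<s) (Σ<-cong c (λ i i<c → f≗g (suc i) (s≤s i<c)))

Σ<-const : ∀ c v → Σ< c (λ _ → v) ≡ c * v
Σ<-const zero v = refl
Σ<-const (suc c) v = cong (v +_) (Σ<-const c v)

-- 0 past the end of the list
nth : List ℕ → ℕ → ℕ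
nth [] i = 0
nth (y ∷ ys) zero = y
nth (y ∷ ys) (suc i) = nth ys i

Σ<-nth : ∀ ys → Σ< (length ys) (nth ys) ≡ sum ys
Σ<-nth [] = refl
Σ<-nth (y ∷ ys) = cong (y +_) (Σ<-nth ys)

nth-∈ : ∀ ys {i} → i < length ys → nth ys i ∈ ys
nth-∈ (y ∷ ys) {zero} _ = here refl
nth-∈ (y ∷ ys) {suc i} (s≤s i<) = there (nth-∈ ys i<)

∈⇒nth : ∀ {ys x} → x ∈ ys → ∃ λ i → i < length ys × nth ys i ≡ x
∈⇒nth (here refl) = 0 , z<s , refl
∈⇒nth (there x∈) = let i , i< , eq = ∈⇒nth x∈ in suc i , s≤s i< , eq

filter++filter∁↭ : ∀ {A : Set} {P : A → Set} (P? : U.Decidable P) xs → filter P? xs ++ filter (∁? P?) xs ↭ xs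
filter++filter∁↭ P? [] = ↭-refl
filter++filter∁↭ P? (x ∷ xs) with P? x
... | yes _ = ↭-prep x (filter++filter∁↭ P? xs)
... | no _ = ↭-trans (↭.shift x (filter P? xs) (filter (∁? P?) xs)) (↭-prep x (filter++filter∁↭ P? xs))

∈⇒≤maxList : ∀ {a xs} → a ∈ xs → a ≤ maxList xs
∈⇒≤maxList {xs = x ∷ xs} (here refl) = m≤m⊔n x (maxList xs)
∈⇒≤maxList {xs = x ∷ xs} (there a∈) = ≤-trans (∈⇒≤maxList a∈) (m≤n⊔m x (maxList xs))

maxList∈ : ∀ x xs → maxList (x ∷ xs) ∈ x ∷ xs
maxList∈ x [] = here (⊔-identityʳ x)
maxList∈ x (y ∷ xs) with ⊔-sel x (maxList (y ∷ xs))
... | inj₁ eq = here eq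
... | inj₂ eq = there (subst (_∈ y ∷ xs) (sym eq) (maxList∈ y xs))

2*[1+n]∸1≡2*n+1 : ∀ n → 2 * suc n ∸ 1 ≡ 2 * n + 1
2*[1+n]∸1≡2*n+1 n = trans (cong (_∸ 1) (trans (*-suc 2 n) (+-comm 2 (2 * n)))) (+-∸-assoc (2 * n) (s≤s z≤n))

Σ-odd : ∀ m → sum (map (λ j → 2 * suc j ∸ 1) (downFrom m)) ≡ m * m
Σ-odd zero = refl
Σ-odd (suc m) = trans (cong (_+ sum (map (λ j → 2 * suc j ∸ 1) (downFrom m))) (2*[1+n]∸1≡2*n+1 m))
                  (trans (cong (2 * m + 1 +_) (Σ-odd m)) (eq m))
  where eq : ∀ m → 2 * m + 1 + m * m ≡ suc m * suc m
        eq = solve-∀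

-- Heights of the vertices of graphOf

-- o and e are as in extraEdges.
extraHeight : ℕ → ℕ → List (ℕ × Bool) → ℕ → ℕ
extraHeight o e [] v = 0
extraHeight o e ((s , false) ∷ ss) v = extraHeight (o + s) e ss v
extraHeight o e ((s , true) ∷ ss) v with v <? e + (s ∸ 1)
... | yes _ = 2 * (o + (v ∸ e)) + 1
... | no _ = extraHeight (o + s) (e + (s ∸ 1)) ss v

heightℕ : List (ℕ × Bool) → ℕ → ℕ
heightℕ ss v with v <? pathLen ss
... | yes _ = 2 * v
... | no _ = extraHeight 0 (pathLen ss) ss v

height : (ss : List (ℕ × Bool)) → Fin (N (graphOf ss)) → ℕ
height ss v = heightℕ ss (toℕ v)

heightℕ-path : ∀ ss {v} → v < pathLen ss → heightℕ ss v ≡ 2 * v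
heightℕ-path ss {v} v<L with v <? pathLen ss
... | yes _ = refl
... | no v≮L = ⊥-elim (v≮L v<L)

heightℕ-extra : ∀ ss {v} → pathLen ss ≤ v → heightℕ ss v ≡ extraHeight 0 (pathLen ss) ss v
heightℕ-extra ss {v} L≤v with v <? pathLen ss
... | yes v<L = ⊥-elim (<⇒≱ v<L L≤v)
... | no _ = refl

m<n∸1⇒1+m<n : ∀ {m n} → m < n ∸ 1 → suc m < n
m<n∸1⇒1+m<n {n = suc n} m<n = s≤s m<n

ladderEdges : ℕ → ℕ → ℕ → List (ℕ × ℕ)
ladderEdges o e s = concatMap (λ x → (e + x , o + x) ∷ (e + x , o + suc x) ∷ []) (upTo (s ∸ 1))

∈-ladderEdges : ∀ {o e s a b} → (a , b) ∈ ladderEdges o e s →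
  ∃ λ x → x < s ∸ 1 × a ≡ e + x × (b ≡ o + x ⊎ b ≡ o + suc x)
∈-ladderEdges {o} {e} {s} ab∈
  with find (∈-concatMap⁻ (λ x → (e + x , o + x) ∷ (e + x , o + suc x) ∷ []) {xs = upTo (s ∸ 1)} ab∈)
... | x , x∈ , here refl = x , ∈-upTo⁻ x∈ , refl , inj₁ refl
... | x , x∈ , there (here refl) = x , ∈-upTo⁻ x∈ , refl , inj₂ refl

extraEdge-near : ∀ o e ss {a b} → (a , b) ∈ extraEdges o e ss →
  e ≤ a × b < o + pathLen ss × Near 1 (extraHeight o e ss a) (2 * b)
extraEdge-near o e ((s , false) ∷ ss) {a} {b} ab∈ with extraEdge-near (o + s) e ss ab∈
... | e≤a , b< , near = e≤a , subst (b <_) (+-assoc o s (pathLen ss)) b< , near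
extraEdge-near o e ((s , true) ∷ ss) {a} {b} ab∈ with ∈-++⁻ (ladderEdges o e s) ab∈
... | inj₂ ab∈ʳ with extraEdge-near (o + s) (e + (s ∸ 1)) ss ab∈ʳ
...   | e′≤a , b< , near with a <? e + (s ∸ 1)
...     | yes a< = ⊥-elim (<⇒≱ a< e′≤a)
...     | no _ = ≤-trans (m≤m+n e (s ∸ 1)) e′≤a , subst (b <_) (+-assoc o s (pathLen ss)) b< , near
extraEdge-near o e ((s , true) ∷ ss) ab∈ | inj₁ ab∈ˡ with ∈-ladderEdges {o} {e} {s} ab∈ˡ
... | x , x< , refl , b≡ with e + x <? e + (s ∸ 1)
...   | no e+x≮ = ⊥-elim (e+x≮ (+-monoʳ-< e x<))
...   | yes _ rewrite m+n∸m≡n e x = m≤m+n e x , b<L b≡ , near b≡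
  where
    1+x<L : o + suc x < o + (s + pathLen ss)
    1+x<L = +-monoʳ-< o (<-≤-trans (m<n∸1⇒1+m<n x<) (m≤m+n s (pathLen ss)))
    b<L : ∀ {b} → b ≡ o + x ⊎ b ≡ o + suc x → b < o + (s + pathLen ss)
    b<L (inj₁ refl) = <-trans (+-monoʳ-< o (n<1+n x)) 1+x<L
    b<L (inj₂ refl) = 1+x<L
    near : ∀ {b} → b ≡ o + x ⊎ b ≡ o + suc x → Near 1 (2 * (o + x) + 1) (2 * b)
    near (inj₁ refl) = ≤-refl , ≤-trans (m≤m+n _ 1) (m≤m+n _ 1)
    near (inj₂ refl) = ≤-trans (n≤1+n _) (≤-trans (≤-reflexive (trans (+-comm 1 _) (eq o x))) (m≤m+n _ 1))
                     , ≤-reflexive (sym (eq o x))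
      where eq : ∀ o x → 2 * (o + x) + 1 + 1 ≡ 2 * (o + suc x)
            eq = solve-∀

edge-near : ∀ ss {a b} → (a , b) ∈ E (graphOf ss) → Near 2 (heightℕ ss a) (heightℕ ss b)
edge-near ss ab∈ with ∈-++⁻ (map (λ i → (i , suc i)) (upTo (pathLen ss ∸ 1))) ab∈
... | inj₁ ab∈ᴾ with ∈-map⁻ (λ i → (i , suc i)) ab∈ᴾ
...   | i , i∈ , refl =
        subst₂ (Near 2) (sym (heightℕ-path ss (<-trans (n<1+n i) 1+i<L))) (sym (heightℕ-path ss 1+i<L))
          (≤-trans (m≤m+n (2 * i) 2) (≤-trans (≤-reflexive (eq i)) (m≤m+n _ 2)) , ≤-reflexive (sym (eq i)))
  where
    1+i<L : suc i < pathLen ss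
    1+i<L = m<n∸1⇒1+m<n (∈-upTo⁻ i∈)
    eq : ∀ i → 2 * i + 2 ≡ 2 * suc i
    eq = solve-∀
edge-near ss {a} {b} ab∈ | inj₂ ab∈ᴱ with extraEdge-near 0 (pathLen ss) ss ab∈ᴱ
... | L≤a , b<L , near rewrite heightℕ-extra ss L≤a | heightℕ-path ss b<L = Near-mono (n≤1+n 1) near

Adj-near : ∀ ss {u v} → Adj (graphOf ss) u v → Near 2 (height ss u) (height ss v)
Adj-near ss (inj₁ uv∈) = edge-near ss uv∈
Adj-near ss (inj₂ vu∈) = Near-sym (edge-near ss vu∈)

Within⇒Near : ∀ ss {r u w} → Within (graphOf ss) r u w → Near (2 * r) (height ss u) (height ss w)
Within⇒Near ss here = Near-refl _ _
Within⇒Near ss {suc r} {u} {w} (step uv wᵥ) =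
  subst (λ d → Near d (height ss u) (height ss w)) (sym (*-suc 2 r)) (Near-trans (Adj-near ss uv) (Within⇒Near ss wᵥ))

pathLen-++ : ∀ pre post → pathLen (pre ++ post) ≡ pathLen pre + pathLen post
pathLen-++ [] post = refl
pathLen-++ ((s , b) ∷ pre) post = trans (cong (s +_) (pathLen-++ pre post)) (sym (+-assoc s _ _))

extraLen-++ : ∀ pre post → extraLen (pre ++ post) ≡ extraLen pre + extraLen post
extraLen-++ [] post = refl
extraLen-++ ((s , false) ∷ pre) post = extraLen-++ pre post
extraLen-++ ((s , true) ∷ pre) post = trans (cong (s ∸ 1 +_) (extraLen-++ pre post)) (sym (+-assoc (s ∸ 1) _ _))

extraHeight-++ : ∀ o e pre post {v} → e + extraLen pre ≤ v →
  extraHeight o e (pre ++ post) v ≡ extraHeight (o + pathLen pre) (e + extraLen pre) post v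
extraHeight-++ o e [] post _ rewrite +-identityʳ o | +-identityʳ e = refl
extraHeight-++ o e ((s , false) ∷ pre) post v≥
  rewrite extraHeight-++ (o + s) e pre post v≥ | +-assoc o s (pathLen pre) = refl
extraHeight-++ o e ((s , true) ∷ pre) post {v} v≥ with v <? e + (s ∸ 1)
... | yes v< = ⊥-elim (<⇒≱ v< (≤-trans (+-monoʳ-≤ e (m≤m+n _ _)) v≥))
... | no _ rewrite extraHeight-++ (o + s) (e + (s ∸ 1)) pre post (≤-trans (≤-reflexive (+-assoc e _ _)) v≥)
                 | +-assoc o s (pathLen pre) | +-assoc e (s ∸ 1) (extraLen pre) = refl

pathVertex : ∀ ss {p} → p < pathLen ss → ∃ λ v → height ss v ≡ 2 * p
pathVertex ss {p} p<L = fromℕ< p<N , trans (cong (heightℕ ss) (toℕ-fromℕ< p<N)) (heightℕ-path ss p<L)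
  where p<N = <-≤-trans p<L (m≤m+n _ _)

extraVertex : ∀ pre ℓ post {x} → suc x < ℓ →
  ∃ λ v → height (pre ++ (ℓ , true) ∷ post) v ≡ 2 * (pathLen pre + x) + 1
extraVertex pre ℓ post {x} 1+x<ℓ = fromℕ< v<N , eq
  where
    ss = pre ++ (ℓ , true) ∷ post
    L = pathLen ss
    e = L + extraLen pre
    x<ℓ∸1 : x < ℓ ∸ 1
    x<ℓ∸1 = ∸-monoˡ-≤ 1 1+x<ℓ
    v<N : e + x < N (graphOf ss)
    v<N = begin-strict
      e + x                           <⟨ +-monoʳ-< e x<ℓ∸1 ⟩
      e + (ℓ ∸ 1)                     ≤⟨ +-monoʳ-≤ e (m≤m+n (ℓ ∸ 1) (extraLen post)) ⟩
      e + (ℓ ∸ 1 + extraLen post)     ≡⟨ +-assoc L _ _ ⟩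
      L + (extraLen pre + (ℓ ∸ 1 + extraLen post)) ≡⟨ cong (L +_) (extraLen-++ pre ((ℓ , true) ∷ post)) ⟨
      L + extraLen ss                 ∎
      where open ≤-Reasoning
    eq : height ss (fromℕ< v<N) ≡ 2 * (pathLen pre + x) + 1
    eq rewrite toℕ-fromℕ< v<N
             | heightℕ-extra ss (≤-trans (m≤m+n L (extraLen pre)) (m≤m+n e x))
             | extraHeight-++ 0 L pre ((ℓ , true) ∷ post) (m≤m+n e x)
      with e + x <? e + (ℓ ∸ 1)
    ... | no ≮ = ⊥-elim (≮ (+-monoʳ-< e x<ℓ∸1))
    ... | yes _ rewrite m+n∸m≡n e x = refl

radius : (K : ℕ) → Fin K → ℕ
radius K i = K ∸ suc (toℕ i)

radius<K : ∀ {K} i → radius K i < K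
radius<K {K} i = ∸-monoʳ-< {K} {suc (toℕ i)} {0} z<s (toℕ<n i)

radius-injective : ∀ {K} {i j : Fin K} → radius K i ≡ radius K j → i ≡ j
radius-injective {K} {i} {j} eq = toℕ-injective (suc-injective (+-cancelʳ-≡ (radius K i) _ _ (begin
  suc (toℕ i) + radius K i ≡⟨ m+[n∸m]≡n (toℕ<n i) ⟩
  K                        ≡⟨ m+[n∸m]≡n (toℕ<n j) ⟨
  suc (toℕ j) + radius K j ≡⟨ cong (suc (toℕ j) +_) eq ⟨
  suc (toℕ j) + radius K i ∎)))
  where open ≡-Reasoning

burning-near : ∀ ss {K bs} → IsBurningSequence (graphOf ss) K bs →
  ∀ v → ∃ λ i → Near (2 * radius K i) (height ss v) (height ss (lookup bs i))
burning-near ss burns v = proj₁ (burns v) , Within⇒Near ss (proj₂ (burns v))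

burning-near-path : ∀ ss {K bs} → IsBurningSequence (graphOf ss) K bs →
  ∀ {p} → p < pathLen ss → ∃ λ i → Near (2 * radius K i) (2 * p) (height ss (lookup bs i))
burning-near-path ss {K} {bs} burns p<L =
  let v , height≡ = pathVertex ss p<L
      i , near = burning-near ss {K} {bs} burns v
  in i , subst (λ h → Near (2 * radius K i) h (height ss (lookup bs i))) height≡ near

burning-near-extra : ∀ ss {K bs} → IsBurningSequence (graphOf ss) K bs →
  ∀ pre ℓ post → ss ≡ pre ++ (ℓ , true) ∷ post → ∀ {x} → suc x < ℓ →
  ∃ λ i → Near (2 * radius K i) (2 * (pathLen pre + x) + 1) (height ss (lookup bs i))
burning-near-extra ss {K} {bs} burns pre ℓ post refl 1+x<ℓ =
  let v , height≡ = extraVertex pre ℓ post 1+x<ℓ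
      i , near = burning-near ss {K} {bs} burns v
  in i , subst (λ h → Near (2 * radius K i) h (height ss (lookup bs i))) height≡ near

Unique-⊆-⊇⇒↭ : ∀ {A : Set} {xs ys : List A} → Unique xs → Unique ys →
  (∀ {x} → x ∈ xs → x ∈ ys) → (∀ {x} → x ∈ ys → x ∈ xs) → xs ↭ ys
Unique-⊆-⊇⇒↭ uxs uys xs⊆ys ys⊆xs = ∼bag⇒↭ (unique∧set⇒bag uxs uys (mk⇔ xs⊆ys ys⊆xs))

module _ {A : Set} (_≟ᴬ_ : DecidableEquality A) where

  private
    ∈-remove : ∀ {x y : A} as bs → y ∈ as ++ x ∷ bs → y ≢ x → y ∈ as ++ bs
    ∈-remove as bs y∈ y≢x with ∈-++⁻ as y∈
    ... | inj₁ y∈as = ∈-++⁺ˡ y∈as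
    ... | inj₂ (here y≡x) = ⊥-elim (y≢x y≡x)
    ... | inj₂ (there y∈bs) = ∈-++⁺ʳ as y∈bs

  Unique-⊆-length⇒⊇ : ∀ {xs ys : List A} → Unique xs → (∀ {x} → x ∈ xs → x ∈ ys) → length ys ≤ length xs →
    ∀ {y} → y ∈ ys → y ∈ xs
  Unique-⊆-length⇒⊇ {[]} {[]} _ _ _ ()
  Unique-⊆-length⇒⊇ {x ∷ xs} {ys} (x∉xs ∷ uxs) xs⊆ys len≤ {y} y∈ys with y ≟ᴬ x
  ... | yes refl = here refl
  ... | no y≢x with ∈-∃++ (xs⊆ys (here refl))
  ...   | as , bs , refl = there (Unique-⊆-length⇒⊇ uxs xs⊆as++bs len≤′ (∈-remove as bs y∈ys y≢x))
    where
      xs⊆as++bs : ∀ {z} → z ∈ xs → z ∈ as ++ bs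
      xs⊆as++bs z∈ = ∈-remove as bs (xs⊆ys (there z∈)) (λ { refl → All.lookup x∉xs z∈ refl })
      len≤′ : length (as ++ bs) ≤ length xs
      len≤′ = ≤-pred (subst (_≤ suc (length xs)) (trans (length-++ as) (trans (+-suc _ _) (cong suc (sym (length-++ as))))) len≤)

  Unique-⊆-length⇒↭ : ∀ {xs ys : List A} → Unique xs → Unique ys → (∀ {x} → x ∈ xs → x ∈ ys) →
    length ys ≤ length xs → xs ↭ ys
  Unique-⊆-length⇒↭ uxs uys xs⊆ys len≤ = Unique-⊆-⊇⇒↭ uxs uys xs⊆ys (Unique-⊆-length⇒⊇ uxs xs⊆ys len≤)

-- Intervals burnt by a burning sequence

injective⇒surjective : ∀ {n} (f : Fin n → Fin n) → (∀ {x y} → f x ≡ f y → x ≡ y) → ∀ y → ∃ λ x → f x ≡ y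
injective⇒surjective f inj y with any? (λ x → f x ≟ᶠ y)
... | yes hit = hit
injective⇒surjective {suc n} f inj y | no miss =
  let i , j , i<j , eq = pigeonhole (n<1+n n) (λ x → punchOut (f≢y {x}))
  in ⊥-elim (<⇒≢ᶠ i<j (inj (punchOut-injective f≢y f≢y eq)))
  where f≢y : ∀ {x} → y ≢ f x
        f≢y {x} eq = miss (x , sym eq)

record IntervalPartition (K : ℕ) : Set where
  field
    centre : Fin K → ℕ
    covers : ∀ p → p < K * K → ∃ λ i → Near (radius K i) (centre i) p
    disjoint : ∀ {p i j} → Near (radius K i) (centre i) p → Near (radius K j) (centre j) p → i ≡ j
    radius≤centre : ∀ i → radius K i ≤ centre i

-- Ball i holds at most 2 r_i + 1 points and Σ_{r<K} (2r + 1) = K², so a covering of the K² points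
-- by the balls is a partition into full intervals.  Concretely, the point q covered by ball i
-- with offset d from the left end is sent to r_i² + d; this is injective, hence onto.
module BallCover (K : ℕ) (g : Fin K → ℕ)
  (reach : ∀ p → p < K * K → ∃ λ i → Near (2 * radius K i) (2 * p) (g i)) where

  private
    r = radius K
    ⌈g/2⌉ : Fin K → ℕ
    ⌈g/2⌉ i = g i / 2 + g i % 2

    ball : Fin (K * K) → Fin K
    ball q = proj₁ (reach (toℕ q) (toℕ<n q))

    near : ∀ q → Near (2 * r (ball q)) (2 * toℕ q) (g (ball q))
    near q = proj₂ (reach (toℕ q) (toℕ<n q))

    bounds : ∀ q → g (ball q) / 2 + g (ball q) % 2 ≤ toℕ q + r (ball q) × toℕ q + r (ball q) ≤ g (ball q) / 2 + 2 * r (ball q)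
    bounds q = Near-double-bounds {r (ball q)} {toℕ q} {g (ball q)} (near q)

    offset : Fin (K * K) → ℕ
    offset q = toℕ q + r (ball q) ∸ ⌈g/2⌉ (ball q)

    offset+⌈g/2⌉ : ∀ q → offset q + ⌈g/2⌉ (ball q) ≡ toℕ q + r (ball q)
    offset+⌈g/2⌉ q = m∸n+n≡m (proj₁ (bounds q))

    offset+parity≤2r : ∀ q → offset q + g (ball q) % 2 ≤ 2 * r (ball q)
    offset+parity≤2r q = +-cancelʳ-≤ (g i / 2) _ _ (begin
      offset q + g i % 2 + g i / 2 ≡⟨ +-assoc (offset q) _ _ ⟩
      offset q + (g i % 2 + g i / 2) ≡⟨ cong (offset q +_) (+-comm (g i % 2) _) ⟩
      offset q + ⌈g/2⌉ i           ≡⟨ offset+⌈g/2⌉ q ⟩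
      toℕ q + r i                  ≤⟨ proj₂ (bounds q) ⟩
      g i / 2 + 2 * r i            ≡⟨ +-comm (g i / 2) _ ⟩
      2 * r i + g i / 2            ∎)
      where open ≤-Reasoning
            i = ball q

    offset≤2r : ∀ q → offset q ≤ 2 * r (ball q)
    offset≤2r q = ≤-trans (m≤m+n _ _) (offset+parity≤2r q)

    slot< : ∀ {i d} → d ≤ 2 * r i → r i * r i + d < K * K
    slot< {i} d≤ = <-≤-trans (square+offset<square {d′ = 0} d≤ (radius<K i)) (≤-reflexive (+-identityʳ _))

    -- abstract, so that unification never unfolds the proof inside fromℕ<
    abstract
      slot : Fin (K * K) → Fin (K * K)
      slot q = fromℕ< (slot< (offset≤2r q))

      toℕ-slot : ∀ q → toℕ (slot q) ≡ r (ball q) * r (ball q) + offset q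
      toℕ-slot q = toℕ-fromℕ< (slot< (offset≤2r q))

    same-ball-offset : ∀ {q q′} → ball q ≡ ball q′ → offset q ≡ offset q′ → q ≡ q′
    same-ball-offset {q} {q′} b≡ o≡ = toℕ-injective (+-cancelʳ-≡ (r (ball q)) _ _ (begin
      toℕ q + r (ball q)                ≡⟨ offset+⌈g/2⌉ q ⟨
      offset q + ⌈g/2⌉ (ball q)         ≡⟨ cong₂ (λ o i → o + ⌈g/2⌉ i) o≡ b≡ ⟩
      offset q′ + ⌈g/2⌉ (ball q′)       ≡⟨ offset+⌈g/2⌉ q′ ⟩
      toℕ q′ + r (ball q′)              ≡⟨ cong (λ i → toℕ q′ + r i) b≡ ⟨
      toℕ q′ + r (ball q)               ∎))
      where open ≡-Reasoning

    slot-injective : ∀ {q q′} → slot q ≡ slot q′ → q ≡ q′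
    slot-injective {q} {q′} eq = same-ball-offset b≡
      (+-cancelˡ-≡ _ _ _ (subst (λ i → r i * r i + offset q ≡ r (ball q′) * r (ball q′) + offset q′) b≡ sq≡))
      where
        sq≡ : r (ball q) * r (ball q) + offset q ≡ r (ball q′) * r (ball q′) + offset q′
        sq≡ = trans (sym (toℕ-slot q)) (trans (cong toℕ eq) (toℕ-slot q′))
        b≡ : ball q ≡ ball q′
        b≡ = radius-injective (square+offset-injective (offset≤2r q) (offset≤2r q′) sq≡)

    preimage : ∀ i {d} (d≤ : d ≤ 2 * r i) → ∃ λ q → slot q ≡ fromℕ< (slot< d≤)
    preimage i d≤ = injective⇒surjective slot slot-injective (fromℕ< (slot< d≤))

    hit : ∀ i {d} → d ≤ 2 * r i → ∃ λ q → ball q ≡ i × offset q ≡ d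
    hit i {d} d≤ = q , b≡ , +-cancelˡ-≡ (r i * r i) _ _ (subst (λ j → r j * r j + offset q ≡ r i * r i + d) b≡ sq≡)
      where
        q = proj₁ (preimage i d≤)
        sq≡ : r (ball q) * r (ball q) + offset q ≡ r i * r i + d
        sq≡ = trans (sym (toℕ-slot q)) (trans (cong toℕ (proj₂ (preimage i d≤))) (toℕ-fromℕ< (slot< d≤)))
        b≡ : ball q ≡ i
        b≡ = radius-injective (square+offset-injective (offset≤2r q) d≤ sq≡)

  even : ∀ i → g i % 2 ≡ 0
  even i = n≤0⇒n≡0 (+-cancelˡ-≤ (2 * r i) (g i % 2) 0 (begin
    2 * r i + g i % 2  ≡⟨ cong (_+ g i % 2) o≡ ⟨
    offset q + g i % 2 ≤⟨ bound ⟩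
    2 * r i            ≡⟨ +-identityʳ (2 * r i) ⟨
    2 * r i + 0        ∎))
    where
      open ≤-Reasoning
      q = proj₁ (hit i (≤-refl {2 * r i}))
      b≡ : ball q ≡ i
      b≡ = proj₁ (proj₂ (hit i (≤-refl {2 * r i})))
      o≡ : offset q ≡ 2 * r i
      o≡ = proj₂ (proj₂ (hit i (≤-refl {2 * r i})))
      bound : offset q + g i % 2 ≤ 2 * r i
      bound = subst (λ j → offset q + g j % 2 ≤ 2 * r j) b≡ (offset+parity≤2r q)

  centre : Fin K → ℕ
  centre i = g i / 2

  g≡2*centre : ∀ i → g i ≡ 2 * centre i
  g≡2*centre i = trans (m≡2*[m/2]+m%2 (g i)) (trans (cong (2 * centre i +_) (even i)) (+-identityʳ _))

  private
    ⌈g/2⌉≡centre : ∀ i → ⌈g/2⌉ i ≡ centre i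
    ⌈g/2⌉≡centre i = trans (cong (centre i +_) (even i)) (+-identityʳ _)

    offset+centre : ∀ {q i} → ball q ≡ i → offset q + centre i ≡ toℕ q + r i
    offset+centre {q} refl = trans (cong (offset q +_) (sym (⌈g/2⌉≡centre (ball q)))) (offset+⌈g/2⌉ q)

    covering-point : ∀ {p i} → Near (r i) (centre i) p → ∃ λ q → toℕ q ≡ p × ball q ≡ i
    covering-point {p} {i} (c≤ , p≤) = q , +-cancelʳ-≡ (r i) (toℕ q) p q+r≡p+r , b≡
      where
        d≤ : p + r i ∸ centre i ≤ 2 * r i
        d≤ = ≤-trans (∸-monoˡ-≤ (centre i) (+-monoˡ-≤ (r i) p≤))
               (≤-reflexive (trans (cong (_∸ centre i) (+-assoc (centre i) (r i) (r i)))
                  (trans (m+n∸m≡n (centre i) (r i + r i)) (cong (r i +_) (sym (+-identityʳ (r i)))))))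
        q = proj₁ (hit i d≤)
        b≡ = proj₁ (proj₂ (hit i d≤))
        q+r≡p+r : toℕ q + r i ≡ p + r i
        q+r≡p+r = begin
          toℕ q + r i                    ≡⟨ offset+centre b≡ ⟨
          offset q + centre i            ≡⟨ cong (_+ centre i) (proj₂ (proj₂ (hit i d≤))) ⟩
          p + r i ∸ centre i + centre i  ≡⟨ m∸n+n≡m c≤ ⟩
          p + r i                        ∎
          where open ≡-Reasoning

    radius≤centre : ∀ i → r i ≤ centre i
    radius≤centre i = subst (r i ≤_) (trans (sym (offset+centre b≡)) (cong (_+ centre i) o≡)) (m≤n+m (r i) (toℕ q))
      where
        q = proj₁ (hit i z≤n)
        b≡ = proj₁ (proj₂ (hit i z≤n))
        o≡ = proj₂ (proj₂ (hit i z≤n))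

  partition : IntervalPartition K
  partition = record
    { centre = centre
    ; covers = λ p p< → let i , near = reach p p< in
        i , Near-sym (Near-double (subst (Near (2 * r i) (2 * p)) (g≡2*centre i) near))
    ; disjoint = λ cᵢ cⱼ → let q , q≡p , bq≡i = covering-point cᵢ
                               q′ , q′≡p , bq′≡j = covering-point cⱼ
                           in trans (sym bq≡i) (trans (cong ball (toℕ-injective (trans q≡p (sym q′≡p)))) bq′≡j)
    ; radius≤centre = radius≤centre
    }

-- Blocks of the path

-- Block e = 0 .. m of P: a gap of gap e vertices (the S- or S′-path, empty for the last
-- blocks) followed by Q_{e+1}, which has 2 (K - 1 - e) + 1 vertices.
module Blocks (K : ℕ) (gap : ℕ → ℕ) where

  R : ℕ → ℕ
  R e = K ∸ suc e

  gapStart : ℕ → ℕ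
  gapStart zero = 0
  gapStart (suc e) = gapStart e + gap e + (2 * R e + 1)

  qStart : ℕ → ℕ
  qStart e = gapStart e + gap e

  gapStart≤qStart : ∀ e → gapStart e ≤ qStart e
  gapStart≤qStart e = m≤m+n (gapStart e) (gap e)

  gapStart-suc : ∀ e → gapStart (suc e) ≡ suc (qStart e + 2 * R e)
  gapStart-suc e = trans (sym (+-assoc (qStart e) (2 * R e) 1)) (+-comm _ 1)

  qEnd<gapStart : ∀ e → qStart e + 2 * R e < gapStart (suc e)
  qEnd<gapStart e = ≤-reflexive (sym (gapStart-suc e))

  qStart<gapStart : ∀ e → qStart e < gapStart (suc e)
  qStart<gapStart e = ≤-<-trans (m≤m+n (qStart e) (2 * R e)) (qEnd<gapStart e)

  gapStart-mono : ∀ {e e′} → e ≤ e′ → gapStart e ≤ gapStart e′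
  gapStart-mono {e′ = zero} z≤n = ≤-refl
  gapStart-mono {e} {suc e′} e≤ with m≤n⇒m<n∨m≡n e≤
  ... | inj₂ refl = ≤-refl
  ... | inj₁ (s≤s e≤e′) = ≤-trans (gapStart-mono e≤e′) (≤-trans (gapStart≤qStart e′) (m≤m+n (qStart e′) (2 * R e′ + 1)))

  qStart<gapStart-later : ∀ {e e′} → e < e′ → qStart e < gapStart e′
  qStart<gapStart-later e<e′ = <-≤-trans (qStart<gapStart _) (gapStart-mono e<e′)

  qStart-mono : ∀ {e e′} → e ≤ e′ → qStart e ≤ qStart e′
  qStart-mono e≤e′ with m≤n⇒m<n∨m≡n e≤e′
  ... | inj₂ refl = ≤-refl
  ... | inj₁ e<e′ = ≤-trans (<⇒≤ (qStart<gapStart-later e<e′)) (gapStart≤qStart _)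

  gapStart-in-gap : ∀ {e e′} → gapStart e ≤ gapStart e′ → gapStart e′ < qStart e → e ≡ e′
  gapStart-in-gap {e} {e′} ≤st′ st′< with <-cmp e e′
  ... | tri< e<e′ _ _ = ⊥-elim (<⇒≱ st′< (<⇒≤ (qStart<gapStart-later e<e′)))
  ... | tri≈ _ e≡e′ _ = e≡e′
  ... | tri> _ _ e′<e = ⊥-elim (<⇒≱ (≤-<-trans (gapStart≤qStart e′) (qStart<gapStart-later e′<e)) ≤st′)

  gapStart≡Σ : ∀ e → gapStart e ≡ Σ< e gap + Σ< e (λ j → 2 * R j + 1)
  gapStart≡Σ zero = refl
  gapStart≡Σ (suc e) = begin
    gapStart e + gap e + (2 * R e + 1)                                  ≡⟨ cong (λ s → s + gap e + (2 * R e + 1)) (gapStart≡Σ e) ⟩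
    Σ< e gap + Σ< e (λ j → 2 * R j + 1) + gap e + (2 * R e + 1)       ≡⟨ eq (Σ< e gap) (Σ< e (λ j → 2 * R j + 1)) (gap e) _ ⟩
    (Σ< e gap + gap e) + (Σ< e (λ j → 2 * R j + 1) + (2 * R e + 1))   ≡⟨ cong₂ _+_ (Σ<-snoc e gap) (Σ<-snoc e (λ j → 2 * R j + 1)) ⟨
    Σ< (suc e) gap + Σ< (suc e) (λ j → 2 * R j + 1)                   ∎
    where open ≡-Reasoning
          eq : ∀ a b c d → a + b + c + d ≡ (a + c) + (b + d)
          eq = solve-∀

  Σ-Q+square : ∀ e → e ≤ K → Σ< e (λ j → 2 * R j + 1) + (K ∸ e) * (K ∸ e) ≡ K * K
  Σ-Q+square zero _ = refl
  Σ-Q+square (suc e) e<K = begin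
    Σ< (suc e) (λ j → 2 * R j + 1) + R e * R e            ≡⟨ cong (_+ R e * R e) (Σ<-snoc e (λ j → 2 * R j + 1)) ⟩
    Σ< e (λ j → 2 * R j + 1) + (2 * R e + 1) + R e * R e   ≡⟨ +-assoc (Σ< e (λ j → 2 * R j + 1)) _ _ ⟩
    Σ< e (λ j → 2 * R j + 1) + (2 * R e + 1 + R e * R e)   ≡⟨ cong (Σ< e (λ j → 2 * R j + 1) +_) (eq (R e)) ⟩
    Σ< e (λ j → 2 * R j + 1) + suc (R e) * suc (R e)       ≡⟨ cong (λ x → Σ< e (λ j → 2 * R j + 1) + x * x) (sym (+-∸-assoc 1 e<K)) ⟩
    Σ< e (λ j → 2 * R j + 1) + (K ∸ e) * (K ∸ e)           ≡⟨ Σ-Q+square e (<⇒≤ e<K) ⟩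
    K * K                                                  ∎
    where open ≡-Reasoning
          eq : ∀ r → 2 * r + 1 + r * r ≡ suc r * suc r
          eq = solve-∀

module SegmentBlocks (K : ℕ) (gapSegment : ℕ → List (ℕ × Bool)) where

  gap : ℕ → ℕ
  gap e = pathLen (gapSegment e)

  open Blocks K gap

  block : ℕ → List (ℕ × Bool)
  block e = gapSegment e ++ (2 * R e + 1 , true) ∷ []

  blocksFrom : ℕ → ℕ → List (ℕ × Bool)
  blocksFrom a zero = []
  blocksFrom a (suc c) = block a ++ blocksFrom (suc a) c

  blocksFrom-+ : ∀ a c d → blocksFrom a (c + d) ≡ blocksFrom a c ++ blocksFrom (a + c) d
  blocksFrom-+ a zero d = cong (λ x → blocksFrom x d) (sym (+-identityʳ a))
  blocksFrom-+ a (suc c) d = begin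
    block a ++ blocksFrom (suc a) (c + d)                    ≡⟨ cong (block a ++_) (blocksFrom-+ (suc a) c d) ⟩
    block a ++ (blocksFrom (suc a) c ++ blocksFrom (suc a + c) d) ≡⟨ ++-assoc (block a) _ _ ⟨
    (block a ++ blocksFrom (suc a) c) ++ blocksFrom (suc a + c) d ≡⟨ cong (λ x → (block a ++ blocksFrom (suc a) c) ++ blocksFrom x d) (sym (+-suc a c)) ⟩
    (block a ++ blocksFrom (suc a) c) ++ blocksFrom (a + suc c) d ∎
    where open ≡-Reasoning

  pathLen-blocksFrom : ∀ e → pathLen (blocksFrom 0 e) ≡ gapStart e
  pathLen-blocksFrom zero = refl
  pathLen-blocksFrom (suc e) = begin
    pathLen (blocksFrom 0 (suc e))                  ≡⟨ cong (λ x → pathLen (blocksFrom 0 x)) (+-comm 1 e) ⟩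
    pathLen (blocksFrom 0 (e + 1))                  ≡⟨ cong pathLen (blocksFrom-+ 0 e 1) ⟩
    pathLen (blocksFrom 0 e ++ block e ++ [])       ≡⟨ pathLen-++ (blocksFrom 0 e) _ ⟩
    pathLen (blocksFrom 0 e) + pathLen (block e ++ []) ≡⟨ cong₂ _+_ (pathLen-blocksFrom e) (cong pathLen (++-identityʳ (block e))) ⟩
    gapStart e + pathLen (block e)                  ≡⟨ cong (gapStart e +_) (pathLen-++ (gapSegment e) _) ⟩
    gapStart e + (gap e + (2 * R e + 1 + 0))        ≡⟨ eq (gapStart e) (gap e) (2 * R e + 1) ⟩
    gapStart e + gap e + (2 * R e + 1)              ∎
    where open ≡-Reasoning
          eq : ∀ a b c → a + (b + (c + 0)) ≡ a + b + c
          eq = solve-∀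

  Q-in-blocks : ∀ {e c} → e < c → ∃₂ λ pre post →
    blocksFrom 0 c ≡ pre ++ (2 * R e + 1 , true) ∷ post × pathLen pre ≡ qStart e
  Q-in-blocks {e} {c} e<c = blocksFrom 0 e ++ gapSegment e , blocksFrom (suc e) (c ∸ suc e) , split , length≡
    where
      split = begin
        blocksFrom 0 c                                                   ≡⟨ cong (blocksFrom 0) (m+[n∸m]≡n e<c) ⟨
        blocksFrom 0 (suc e + (c ∸ suc e))                               ≡⟨ cong (λ x → blocksFrom 0 (x + (c ∸ suc e))) (+-comm 1 e) ⟩
        blocksFrom 0 (e + 1 + (c ∸ suc e))                               ≡⟨ cong (blocksFrom 0) (+-assoc e 1 (c ∸ suc e)) ⟩
        blocksFrom 0 (e + suc (c ∸ suc e))                               ≡⟨ blocksFrom-+ 0 e (suc (c ∸ suc e)) ⟩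
        blocksFrom 0 e ++ block e ++ blocksFrom (suc e) (c ∸ suc e)       ≡⟨ cong (blocksFrom 0 e ++_) (++-assoc (gapSegment e) _ _) ⟩
        blocksFrom 0 e ++ gapSegment e ++ (2 * R e + 1 , true) ∷ blocksFrom (suc e) (c ∸ suc e) ≡⟨ ++-assoc (blocksFrom 0 e) _ _ ⟨
        (blocksFrom 0 e ++ gapSegment e) ++ (2 * R e + 1 , true) ∷ blocksFrom (suc e) (c ∸ suc e) ∎
        where open ≡-Reasoning
      length≡ = trans (pathLen-++ (blocksFrom 0 e) (gapSegment e)) (cong (_+ gap e) (pathLen-blocksFrom e))

  concatMap-applyUpTo : ∀ {A : Set} (f : A → List (ℕ × Bool)) (g : ℕ → A) a c →
    (∀ i → i < c → f (g i) ≡ block (a + i)) → concatMap f (applyUpTo g c) ≡ blocksFrom a c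
  concatMap-applyUpTo f g a zero _ = refl
  concatMap-applyUpTo f g a (suc c) f≡ =
    cong₂ _++_ (trans (f≡ 0 z<s) (cong block (+-identityʳ a)))
      (concatMap-applyUpTo f (λ i → g (suc i)) (suc a) c (λ i i<c → trans (f≡ (suc i) (s≤s i<c)) (cong block (+-suc a i))))

  concatMap-zip-applyUpTo : ∀ (f : ℕ × ℕ → List (ℕ × Bool)) (g : ℕ → ℕ) a ys →
    (∀ i → i < length ys → f (nth ys i , g i) ≡ block (a + i)) →
    concatMap f (zip ys (applyUpTo g (length ys))) ≡ blocksFrom a (length ys)
  concatMap-zip-applyUpTo f g a [] _ = refl
  concatMap-zip-applyUpTo f g a (y ∷ ys) f≡ =
    cong₂ _++_ (trans (f≡ 0 z<s) (cong block (+-identityʳ a)))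
      (concatMap-zip-applyUpTo f (λ i → g (suc i)) (suc a) ys (λ i i< → trans (f≡ (suc i) (s≤s i<)) (cong block (+-suc a i))))

-- Positions of the intervals

-- Interval lengths 2a - 1 for a ∈ X, where B/4 < a < B/2 and B′ = 2B - 3.
module _ {B B′ : ℕ} (B′+3≡2B : B′ + 3 ≡ 2 * B) where

  private
    B+B≡B′+3 : B + B ≡ B′ + 3
    B+B≡B′+3 = trans (cong (B +_) (sym (+-identityʳ B))) (sym B′+3≡2B)

  one-length<B′ : ∀ {a} → 2 * suc a < B → 2 * a + 1 < B′
  one-length<B′ {a} 2a<B = +-cancelʳ-≤ 3 _ _ (begin
    suc (2 * a + 1) + 3 ≡⟨ eq a ⟩
    2 * suc a + 3       ≤⟨ +-mono-≤ (<⇒≤ 2a<B) (≤-trans (s≤s (*-monoʳ-≤ 2 (s≤s z≤n))) 2a<B) ⟩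
    B + B               ≡⟨ B+B≡B′+3 ⟩
    B′ + 3              ∎)
    where open ≤-Reasoning
          eq : ∀ a → suc (2 * a + 1) + 3 ≡ 2 * suc a + 3
          eq = solve-∀

  two-lengths<B′ : ∀ {a b} → 2 * suc a < B → 2 * suc b < B → 2 * a + 1 + (2 * b + 1) < B′
  two-lengths<B′ {a} {b} 2a<B 2b<B = +-cancelʳ-≤ 3 _ _ (begin
    suc (2 * a + 1 + (2 * b + 1)) + 3 ≡⟨ eq a b ⟩
    suc (2 * suc a) + suc (2 * suc b) ≤⟨ +-mono-≤ 2a<B 2b<B ⟩
    B + B                             ≡⟨ B+B≡B′+3 ⟩
    B′ + 3                            ∎)
    where open ≤-Reasoning
          eq : ∀ a b → suc (2 * a + 1 + (2 * b + 1)) + 3 ≡ suc (2 * suc a) + suc (2 * suc b)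
          eq = solve-∀

  four-lengths>B′ : ∀ {a b c d} → B < 4 * suc a → B < 4 * suc b → B < 4 * suc c → B < 4 * suc d →
    2 * a + 1 + (2 * b + 1) + (2 * c + 1) + (2 * d + 1) ≤ B′ → ⊥
  four-lengths>B′ {a} {b} {c} {d} a> b> c> d> sum≤B′ = n≮n (2 * (B + B) + 2) (begin-strict
    2 * (B + B) + 2                  <⟨ +-monoʳ-< (2 * (B + B)) (s≤s (s≤s (s≤s z≤n))) ⟩
    2 * (B + B) + 4                  ≡⟨ eq₁ B ⟩
    suc B + suc B + suc B + suc B    ≤⟨ +-mono-≤ (+-mono-≤ (+-mono-≤ a> b>) c>) d> ⟩
    4 * suc a + 4 * suc b + 4 * suc c + 4 * suc d ≡⟨ eq₂ a b c d ⟩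
    2 * (2 * a + 1 + (2 * b + 1) + (2 * c + 1) + (2 * d + 1)) + 8 ≤⟨ +-monoˡ-≤ 8 (*-monoʳ-≤ 2 sum≤B′) ⟩
    2 * B′ + 8                       ≡⟨ eq₃ B′ ⟩
    2 * (B′ + 3) + 2                 ≡⟨ cong (λ x → 2 * x + 2) B+B≡B′+3 ⟨
    2 * (B + B) + 2                  ∎)
    where open ≤-Reasoning
          eq₁ : ∀ B → 2 * (B + B) + 4 ≡ suc B + suc B + suc B + suc B
          eq₁ = solve-∀
          eq₂ : ∀ a b c d → 4 * suc a + 4 * suc b + 4 * suc c + 4 * suc d
                          ≡ 2 * (2 * a + 1 + (2 * b + 1) + (2 * c + 1) + (2 * d + 1)) + 8
          eq₂ = solve-∀
          eq₃ : ∀ x → 2 * x + 8 ≡ 2 * (x + 3) + 2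
          eq₃ = solve-∀

  three-lengths≡B′ : ∀ {a b c} → 2 * a + 1 + (2 * b + 1) + (2 * c + 1) ≡ B′ → suc a + suc b + suc c ≡ B
  three-lengths≡B′ {a} {b} {c} sum≡B′ = *-cancelˡ-≡ _ B 2 (begin
    2 * (suc a + suc b + suc c)                       ≡⟨ eq a b c ⟩
    2 * a + 1 + (2 * b + 1) + (2 * c + 1) + 3         ≡⟨ cong (_+ 3) sum≡B′ ⟩
    B′ + 3                                            ≡⟨ B′+3≡2B ⟩
    2 * B                                             ∎)
    where open ≡-Reasoning
          eq : ∀ a b c → 2 * (suc a + suc b + suc c) ≡ 2 * a + 1 + (2 * b + 1) + (2 * c + 1) + 3
          eq = solve-∀

two-lengths>odd : ∀ {B m t a b} → B < 4 * suc a → B < 4 * suc b → 2 * m < B → t < m →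
  2 * a + 1 + (2 * b + 1) ≤ 2 * t + 1 → ⊥
two-lengths>odd {B} {m} {t} {a} {b} a> b> 2m<B t<m sum≤ = n≮n (4 * m) (begin-strict
  4 * m                  <⟨ m<m+n (4 * m) (s≤s z≤n) ⟩
  4 * m + 2              ≡⟨ eq₁ m ⟩
  2 * suc (2 * m)        ≤⟨ *-monoʳ-≤ 2 2m<B ⟩
  2 * B                  <⟨ m<m+n (2 * B) (s≤s z≤n) ⟩
  2 * B + 2              ≡⟨ eq₂ B ⟩
  suc B + suc B          ≤⟨ +-mono-≤ a> b> ⟩
  4 * suc a + 4 * suc b  ≡⟨ eq₃ a b ⟩
  4 * (a + b + 2)        ≤⟨ *-monoʳ-≤ 4 a+b+2≤m ⟩
  4 * m                  ∎)
  where
    open ≤-Reasoning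
    eq₁ : ∀ m → 4 * m + 2 ≡ 2 * suc (2 * m)
    eq₁ = solve-∀
    eq₂ : ∀ B → 2 * B + 2 ≡ suc B + suc B
    eq₂ = solve-∀
    eq₃ : ∀ a b → 4 * suc a + 4 * suc b ≡ 4 * (a + b + 2)
    eq₃ = solve-∀
    a+b+2≤m : a + b + 2 ≤ m
    a+b+2≤m = ≤-trans (≤-reflexive (sym (+-assoc (a + b) 1 1))) (≤-trans (+-monoˡ-≤ 1 (2*m≤2*n+1⇒m≤n {a + b + 1} {t}
                (≤-trans (≤-reflexive (eq a b)) sum≤))) (≤-trans (≤-reflexive (+-comm t 1)) t<m))
      where eq : ∀ a b → 2 * (a + b + 1) ≡ 2 * a + 1 + (2 * b + 1)
            eq = solve-∀

module Positions (m : ℕ) (P : IntervalPartition (2 * m + 1)) (gap : ℕ → ℕ) where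

  K = 2 * m + 1

  open IntervalPartition P public
  open Blocks K gap public

  r : Fin K → ℕ
  r = radius K

  infix 4 _∈[_]
  _∈[_] : ℕ → Fin K → Set
  p ∈[ i ] = Near (r i) (centre i) p

  ∈[]-width : ∀ {p d i} → p ∈[ i ] → p + d ∈[ i ] → d ≤ 2 * r i
  ∈[]-width {p} {d} {i} (c≤p+r , _) (_ , p+d≤c+r) = +-cancelˡ-≤ p _ _ (begin
    p + d           ≤⟨ p+d≤c+r ⟩
    centre i + r i  ≤⟨ +-monoˡ-≤ (r i) c≤p+r ⟩
    p + r i + r i   ≡⟨ +-assoc p (r i) (r i) ⟩
    p + (r i + r i) ≡⟨ cong (p +_) (cong (r i +_) (+-identityʳ (r i))) ⟨
    p + 2 * r i     ∎)
    where open ≤-Reasoning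

  ∈[]-fills : ∀ {a i} → a ∈[ i ] → a + 2 * r i ∈[ i ] → centre i ≡ a + r i
  ∈[]-fills {a} {i} (c≤a+r , _) (_ , a+2r≤c+r) =
    ≤-antisym c≤a+r (+-cancelʳ-≤ (r i) _ _ (≤-trans (≤-reflexive (eq a (r i))) a+2r≤c+r))
    where eq : ∀ a r → a + r + r ≡ a + 2 * r
          eq = solve-∀

  ≤m⇒<K : ∀ {e} → e ≤ m → e < K
  ≤m⇒<K e≤m = ≤-trans (s≤s (≤-trans e≤m (m≤m+n m (m + 0)))) (≤-reflexive (+-comm 1 (2 * m)))

  abstract
    index : ∀ {e} → e ≤ m → Fin K
    index e≤m = fromℕ< (≤m⇒<K e≤m)

    toℕ-index : ∀ {e} (e≤m : e ≤ m) → toℕ (index e≤m) ≡ e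
    toℕ-index e≤m = toℕ-fromℕ< (≤m⇒<K e≤m)

  module _ (total : gapStart (suc m) ≡ K * K)
           (linked : ∀ e → e ≤ m → ∀ x → suc x < 2 * R e + 1 →
                     ∃ λ i → qStart e + x ∈[ i ] × qStart e + suc x ∈[ i ]) where

    qStart<K² : ∀ {e} → e ≤ m → qStart e < K * K
    qStart<K² {e} e≤m = <-≤-trans (qStart<gapStart e) (subst (gapStart (suc e) ≤_) total (gapStart-mono (s≤s e≤m)))

    Q-in-interval : ∀ {e i} → e ≤ m → qStart e ∈[ i ] → ∀ x → x ≤ 2 * R e → qStart e + x ∈[ i ]
    Q-in-interval {e} {i} e≤m q∈ zero _ = subst (_∈[ i ]) (sym (+-identityʳ _)) q∈
    Q-in-interval {e} {i} e≤m q∈ (suc x) 1+x≤ with linked e e≤m x (≤-trans (s≤s 1+x≤) (≤-reflexive (+-comm 1 (2 * R e))))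
    ... | j , x∈j , 1+x∈j = subst (qStart e + suc x ∈[_]) (sym (disjoint (Q-in-interval e≤m q∈ x (<⇒≤ 1+x≤)) x∈j)) 1+x∈j

    -- The interval holding Q_{e+1} has radius at least R e, hence index at most e, and by
    -- induction the smaller indices belong to the earlier Q-paths.
    Q-interval : ∀ e → e ≤ m → ∀ i → toℕ i ≡ e → centre i ≡ qStart e + R e
    Q-interval = <-rec _ induct
      where
        induct : ∀ e → (∀ {e′} → e′ < e → e′ ≤ m → ∀ i → toℕ i ≡ e′ → centre i ≡ qStart e′ + R e′) →
               e ≤ m → ∀ i → toℕ i ≡ e → centre i ≡ qStart e + R e
        induct e IH e≤m i i≡e with covers (qStart e) (qStart<K² e≤m)
        ... | j , q∈j = subst (λ k → centre k ≡ qStart e + R e) j≡i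
                          (trans (∈[]-fills (subst (_∈[ j ]) (+-identityʳ _) Q₀) (subst (λ x → qStart e + 2 * x ∈[ j ]) (sym rj≡Re) Q₂))
                                 (cong (qStart e +_) rj≡Re))
          where
            Q₀ = Q-in-interval e≤m q∈j 0 z≤n
            Q₂ = Q-in-interval e≤m q∈j (2 * R e) ≤-refl
            Re≤rj : R e ≤ r j
            Re≤rj = *-cancelˡ-≤ 2 (∈[]-width q∈j Q₂)
            j≤e : toℕ j ≤ e
            j≤e = ≮⇒≥ (λ e<j → <⇒≱ (∸-monoʳ-< (s≤s e<j) (toℕ<n j)) Re≤rj)
            j≡e : toℕ j ≡ e
            j≡e with m≤n⇒m<n∨m≡n j≤e
            ... | inj₂ eq = eq
            ... | inj₁ j<e = ⊥-elim (<⇒≱ (<-≤-trans (qEnd<gapStart (toℕ j)) (gapStart-mono j<e)) (begin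
                gapStart e                      ≤⟨ gapStart≤qStart e ⟩
                qStart e                        ≤⟨ proj₂ q∈j ⟩
                centre j + r j                  ≡⟨ cong (_+ r j) (IH j<e (≤-trans (<⇒≤ j<e) e≤m) j refl) ⟩
                qStart (toℕ j) + R (toℕ j) + R (toℕ j) ≡⟨ eq (qStart (toℕ j)) (R (toℕ j)) ⟩
                qStart (toℕ j) + 2 * R (toℕ j)  ∎))
              where open ≤-Reasoning
                    eq : ∀ a b → a + b + b ≡ a + 2 * b
                    eq = solve-∀
            j≡i : j ≡ i
            j≡i = toℕ-injective (trans j≡e (sym i≡e))
            rj≡Re : r j ≡ R e
            rj≡Re = cong R j≡e

    Q-covered : ∀ {e i x} → e ≤ m → toℕ i ≡ e → x ≤ 2 * R e → qStart e + x ∈[ i ]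
    Q-covered {e} {i} {x} e≤m i≡e x≤ = subst₂ (λ c s → Near s c (qStart e + x)) (sym c≡) (cong R (sym i≡e))
      (+-monoˡ-≤ (R e) (m≤m+n (qStart e) x) , ≤-trans (+-monoʳ-≤ (qStart e) x≤) (≤-reflexive (eq (qStart e) (R e))))
      where c≡ = Q-interval e e≤m i i≡e
            eq : ∀ a b → a + 2 * b ≡ a + b + b
            eq = solve-∀

    ∈[]-extend-left : ∀ {b p i} → suc b ≤ p → p ∈[ i ] → centre i < suc b + r i → b ∈[ i ]
    ∈[]-extend-left b<p (_ , p≤c+r) c< = ≤-pred c< , ≤-trans (<⇒≤ b<p) p≤c+r

    InGap : ℕ → ℕ → Set
    InGap e p = gapStart e ≤ p × p < qStart e

    gap-index>m : ∀ {e p i} → InGap e p → p ∈[ i ] → m < toℕ i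
    gap-index>m {e} {p} {i} (st≤p , p<q) p∈i with m <? toℕ i
    ... | yes m<i = m<i
    ... | no m≮i with toℕ i <? e
    ...   | yes i<e = ⊥-elim (<⇒≱ (<-≤-trans (qEnd<gapStart (toℕ i)) (gapStart-mono i<e)) (≤-trans st≤p (begin
            p                         ≤⟨ proj₂ p∈i ⟩
            centre i + r i            ≡⟨ cong (_+ r i) (Q-interval (toℕ i) (≮⇒≥ m≮i) i refl) ⟩
            qStart (toℕ i) + r i + r i ≡⟨ eq (qStart (toℕ i)) (r i) ⟩
            qStart (toℕ i) + 2 * r i  ∎)))
      where open ≤-Reasoning
            eq : ∀ a b → a + b + b ≡ a + 2 * b
            eq = solve-∀
    ...   | no i≮e = ⊥-elim (<⇒≱ p<q (≤-trans (qStart-mono (≮⇒≥ i≮e))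
              (+-cancelʳ-≤ (r i) _ _ (subst (_≤ p + r i) (Q-interval (toℕ i) (≮⇒≥ m≮i) i refl) (proj₁ p∈i)))))

    gap-radius<m : ∀ {e p i} → InGap e p → p ∈[ i ] → r i < m
    gap-radius<m {i = i} gp p∈i = +-cancelʳ-< (suc (toℕ i)) (r i) m (begin-strict
      r i + suc (toℕ i)  ≡⟨ m∸n+n≡m (toℕ<n i) ⟩
      2 * m + 1          ≡⟨ eq m ⟩
      m + suc m          <⟨ +-monoʳ-< m (s≤s (gap-index>m gp p∈i)) ⟩
      m + suc (toℕ i)    ∎)
      where open ≤-Reasoning
            eq : ∀ m → 2 * m + 1 ≡ m + suc m
            eq = solve-∀

    gap-interval-ends : ∀ {e p i} → e ≤ m → InGap e p → p ∈[ i ] → centre i + r i < qStart e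
    gap-interval-ends {e} {p} {i} e≤m gp p∈i with centre i + r i <? qStart e
    ... | yes ends = ends
    ... | no ≮ends = ⊥-elim (<⇒≱ (gap-index>m gp p∈i) (≤-trans (≤-reflexive (trans (cong toℕ i≡e) (toℕ-index e≤m))) e≤m))
      where
        q∈i : qStart e ∈[ i ]
        q∈i = ≤-trans (proj₁ p∈i) (+-monoˡ-≤ (r i) (<⇒≤ (proj₂ gp))) , ≮⇒≥ ≮ends
        i≡e : i ≡ index e≤m
        i≡e = disjoint q∈i (subst (_∈[ index e≤m ]) (+-identityʳ _) (Q-covered e≤m (toℕ-index e≤m) z≤n))

    gap-interval-starts : ∀ {e p i} → e ≤ m → InGap e p → p ∈[ i ] → gapStart e + r i ≤ centre i
    gap-interval-starts {zero} {p} {i} _ _ _ = radius≤centre i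
    gap-interval-starts {suc e} {p} {i} e<m gp p∈i with gapStart (suc e) + r i ≤? centre i
    ... | yes starts = starts
    ... | no ≮starts = ⊥-elim (<⇒≱ (gap-index>m gp p∈i) (≤-trans (≤-reflexive (trans (cong toℕ i≡e) (toℕ-index e≤m))) e≤m))
      where
        e≤m = ≤-trans (n≤1+n e) e<m
        end∈i : qStart e + 2 * R e ∈[ i ]
        end∈i = ∈[]-extend-left (subst (_≤ p) (gapStart-suc e) (proj₁ gp)) p∈i
                  (subst (λ s → centre i < s + r i) (gapStart-suc e) (≰⇒> ≮starts))
        i≡e : i ≡ index e≤m
        i≡e = disjoint end∈i (Q-covered e≤m (toℕ-index e≤m) ≤-refl)

    Starts : Fin K → ℕ → Set
    Starts i p = centre i ≡ p + r i

    next : Fin K → ℕ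
    next i = suc (centre i + r i)

    next-Starts : ∀ {i p} → Starts i p → next i ≡ p + (2 * r i + 1)
    next-Starts {i} {p} c≡ = trans (cong (λ c → suc (c + r i)) c≡) (eq p (r i))
      where eq : ∀ p r → suc (p + r + r) ≡ p + (2 * r + 1)
            eq = solve-∀

    end∈[] : ∀ i → centre i + r i ∈[ i ]
    end∈[] i = ≤-trans (m≤m+n (centre i) (r i)) (m≤m+n _ (r i)) , ≤-refl

    starts-after : ∀ {i′ i p} → next i′ ≡ p → p ∈[ i ] → p + r i ≤ centre i
    starts-after {i′} {i} {p} refl p∈i with p + r i ≤? centre i
    ... | yes starts = starts
    ... | no ≮starts = ⊥-elim (n≮n _ (subst (λ j → next i′ ≤ centre j + r j) (sym i′≡i) (proj₂ p∈i)))
      where i′≡i = disjoint (end∈[] i′) (∈[]-extend-left ≤-refl p∈i (≰⇒> ≮starts))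

    Boundary : ℕ → ℕ → Set
    Boundary e p = p ≡ gapStart e ⊎ ∃ λ i′ → next i′ ≡ p

    interval-at : ∀ {e p} → e ≤ m → InGap e p → Boundary e p →
      ∃ λ i → p ∈[ i ] × Starts i p × next i ≤ qStart e × r i < m
    interval-at {e} {p} e≤m gp bd with covers p (<-trans (proj₂ gp) (qStart<K² e≤m))
    ... | i , p∈i = i , p∈i , ≤-antisym (proj₁ p∈i) (starts bd) , gap-interval-ends e≤m gp p∈i , gap-radius<m gp p∈i
      where
        starts : Boundary e p → p + r i ≤ centre i
        starts (inj₁ refl) = gap-interval-starts e≤m gp p∈i
        starts (inj₂ (i′ , next≡p)) = starts-after next≡p p∈i

    module Gaps (X : List ℕ) (B B′ n k : ℕ)
      (bounds : ∀ {a} → a ∈ X → B < 4 * a × 2 * a < B)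
      (2m<B : 2 * m < B)
      (B′+3≡2B : B′ + 3 ≡ 2 * B)
      (n+k≤m : n + k ≤ m)
      (S-gap-length : ∀ {e} → e < n → gap e ≡ B′)
      (S′-gap-length : ∀ {e} → n ≤ e × e < n + k → ∃ λ t → gap e ≡ 2 * t + 1 × t < m × suc t ∉ X)
      (S′-gap-for : ∀ {t} → t < m → suc t ∉ X → ∃ λ e → (n ≤ e × e < n + k) × gap e ≡ 2 * t + 1)
      where

      S′Gap : ℕ → Set
      S′Gap e = n ≤ e × e < n + k

      len : Fin K → ℕ
      len i = 2 * r i + 1

      S′Gap⇒≤m : ∀ {e} → S′Gap e → e ≤ m
      S′Gap⇒≤m (_ , e<n+k) = ≤-trans (<⇒≤ e<n+k) n+k≤m

      odd-gap-InGap : ∀ {e t} → gap e ≡ 2 * t + 1 → InGap e (gapStart e)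
      odd-gap-InGap {e} {t} gap≡ = ≤-refl , m<m+n (gapStart e) (subst (0 <_) (sym gap≡) (m≤n+m 1 (2 * t)))

      OneIntervalS′Gaps : ℕ → Set
      OneIntervalS′Gaps y = ∀ {e} → S′Gap e → gap e ≡ y → ∀ {i} → gapStart e ∈[ i ] → Starts i (gapStart e) × next i ≡ qStart e

      nonX-interval-starts-S′Gap : ∀ {i} → r i < m → suc (r i) ∉ X → OneIntervalS′Gaps (len i) →
        ∃ λ e → S′Gap e × gap e ≡ len i × Starts i (gapStart e)
      nonX-interval-starts-S′Gap {i} r<m i∉X single with S′-gap-for r<m i∉X
      ... | e , S′e , gap≡ with covers (gapStart e) (<-trans (proj₂ (odd-gap-InGap {t = r i} gap≡)) (qStart<K² (S′Gap⇒≤m S′e)))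
      ...   | i′ , st∈i′ with single S′e gap≡ st∈i′
      ...     | starts , next≡q = e , S′e , gap≡ , subst (λ j → Starts j (gapStart e)) i′≡i starts
        where
          i′≡i : i′ ≡ i
          i′≡i = radius-injective (*-cancelˡ-≡ (r i′) (r i) 2 (+-cancelʳ-≡ 1 (2 * r i′) (2 * r i) (+-cancelˡ-≡ (gapStart e) (len i′) (len i)
                   (trans (sym (next-Starts starts)) (trans next≡q (cong (gapStart e +_) gap≡))))))

      nonX-interval-fills-gap : ∀ {e p i} → InGap e p → Starts i p → r i < m → suc (r i) ∉ X → OneIntervalS′Gaps (len i) →
        S′Gap e × p ≡ gapStart e × gap e ≡ len i
      nonX-interval-fills-gap {e} {p} {i} (st≤p , p<q) starts r<m i∉X single =
        subst S′Gap (sym e≡e′) S′e′ , trans p≡st′ (cong gapStart (sym e≡e′)) , trans (cong gap e≡e′) gap≡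
        where
          position = nonX-interval-starts-S′Gap r<m i∉X single
          e′ = proj₁ position
          S′e′ = proj₁ (proj₂ position)
          gap≡ = proj₁ (proj₂ (proj₂ position))
          p≡st′ : p ≡ gapStart e′
          p≡st′ = +-cancelʳ-≡ (r i) p (gapStart e′) (trans (sym starts) (proj₂ (proj₂ (proj₂ position))))
          e≡e′ : e ≡ e′
          e≡e′ = gapStart-in-gap {e} {e′} (subst (gapStart e ≤_) p≡st′ st≤p) (subst (_< qStart e) p≡st′ p<q)

      <next : ∀ {i p} → Starts i p → p < next i
      <next {i} {p} starts = subst (p <_) (sym (next-Starts starts)) (m<m+n p (m≤n+m 1 (2 * r i)))

      lengths≤gap : ∀ {e i i₂} → Starts i (gapStart e) → Starts i₂ (next i) → next i₂ ≤ qStart e → len i + len i₂ ≤ gap e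
      lengths≤gap {e} {i} {i₂} starts starts₂ fits₂ = +-cancelˡ-≤ (gapStart e) _ _ (begin
        gapStart e + (len i + len i₂) ≡⟨ +-assoc (gapStart e) (len i) (len i₂) ⟨
        gapStart e + len i + len i₂   ≡⟨ cong (_+ len i₂) (next-Starts starts) ⟨
        next i + len i₂               ≡⟨ next-Starts starts₂ ⟨
        next i₂                       ≤⟨ fits₂ ⟩
        qStart e                      ∎)
        where open ≤-Reasoning

      -- An X-interval never shares an S′-gap with another interval: it is followed either by
      -- another X-interval (the two are too long together) or by a non-X-interval, which fills a gap.
      X-interval-not-in-S′Gap : ∀ {e y i} → (∀ {y′} → y′ < y → OneIntervalS′Gaps y′) → S′Gap e → gap e ≡ y →
        Starts i (gapStart e) → suc (r i) ∈ X → next i < qStart e → ⊥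
      X-interval-not-in-S′Gap {e} {y} {i} IH S′e gap≡y starts i∈X next< = second (suc (r i₂) ∈? X)
        where
          second-interval = interval-at (S′Gap⇒≤m S′e) (<⇒≤ (<next starts) , next<) (inj₂ (i , refl))
          i₂ = proj₁ second-interval
          starts₂ : Starts i₂ (next i)
          starts₂ = proj₁ (proj₂ (proj₂ second-interval))
          lengths≤ : len i + len i₂ ≤ gap e
          lengths≤ = lengths≤gap starts starts₂ (proj₁ (proj₂ (proj₂ (proj₂ second-interval))))
          second : Dec (suc (r i₂) ∈ X) → ⊥
          second (yes i₂∈X) = two-lengths>odd (proj₁ (bounds i∈X)) (proj₁ (bounds i₂∈X)) 2m<B (proj₁ (proj₂ (proj₂ (S′-gap-length S′e))))
                                (subst (len i + len i₂ ≤_) (proj₁ (proj₂ (S′-gap-length S′e))) lengths≤)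
          second (no i₂∉X) = <-irrefl (sym next≡st) (<next starts)
            where
              shorter : len i₂ < y
              shorter = <-≤-trans (m<n+m (len i₂) (m≤n+m 1 (2 * r i))) (subst (len i + len i₂ ≤_) gap≡y lengths≤)
              next≡st : next i ≡ gapStart e
              next≡st = proj₁ (proj₂ (nonX-interval-fills-gap (<⇒≤ (<next starts) , next<) starts₂
                          (proj₂ (proj₂ (proj₂ (proj₂ second-interval)))) i₂∉X (IH shorter)))

      S′-gaps-one-interval : ∀ y → OneIntervalS′Gaps y
      S′-gaps-one-interval = <-rec OneIntervalS′Gaps induct
        where
          induct : ∀ y → (∀ {y′} → y′ < y → OneIntervalS′Gaps y′) → OneIntervalS′Gaps y
          induct y IH {e} S′e gap≡y {i} st∈i =
            subst (λ j → Starts j (gapStart e) × next j ≡ qStart e) (disjoint (proj₁ (proj₂ first)) st∈i)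
              (starts₀ , fills (m≤n⇒m<n∨m≡n (proj₁ (proj₂ (proj₂ (proj₂ first))))))
            where
              in-gap = odd-gap-InGap {t = proj₁ (S′-gap-length S′e)} (proj₁ (proj₂ (S′-gap-length S′e)))
              first = interval-at (S′Gap⇒≤m S′e) in-gap (inj₁ refl)
              i₀ = proj₁ first
              starts₀ : Starts i₀ (gapStart e)
              starts₀ = proj₁ (proj₂ (proj₂ first))
              fills : next i₀ < qStart e ⊎ next i₀ ≡ qStart e → next i₀ ≡ qStart e
              fills (inj₂ next≡q) = next≡q
              fills (inj₁ next<q) = ⊥-elim (beyond (suc (r i₀) ∈? X))
                where
                  beyond : Dec (suc (r i₀) ∈ X) → ⊥
                  beyond (yes i₀∈X) = X-interval-not-in-S′Gap IH S′e gap≡y starts₀ i₀∈X next<q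
                  beyond (no i₀∉X) = <-irrefl (trans (next-Starts starts₀) (cong (gapStart e +_) (sym gap≡len))) next<q
                    where
                      shorter : len i₀ < y
                      shorter = +-cancelˡ-< (gapStart e) (len i₀) y
                                  (subst₂ _<_ (next-Starts starts₀) (cong (gapStart e +_) gap≡y) next<q)
                      gap≡len : gap e ≡ len i₀
                      gap≡len = proj₂ (proj₂ (nonX-interval-fills-gap in-gap starts₀
                                  (proj₂ (proj₂ (proj₂ (proj₂ first)))) i₀∉X (IH shorter)))

      S-gap-interval : ∀ {e p} → e < n → InGap e p → Boundary e p →
        ∃ λ i → Starts i p × next i ≤ qStart e × suc (r i) ∈ X
      S-gap-interval {e} e<n gp bd = i , starts , proj₁ (proj₂ (proj₂ (proj₂ found))) , in-X (suc (r i) ∈? X)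
        where
          found = interval-at (≤-trans (<⇒≤ e<n) (≤-trans (m≤m+n n k) n+k≤m)) gp bd
          i = proj₁ found
          starts = proj₁ (proj₂ (proj₂ found))
          in-X : Dec (suc (r i) ∈ X) → suc (r i) ∈ X
          in-X (yes i∈X) = i∈X
          in-X (no i∉X) = ⊥-elim (<⇒≱ e<n (proj₁ (proj₁ (nonX-interval-fills-gap gp starts
                            (proj₂ (proj₂ (proj₂ (proj₂ found)))) i∉X (S′-gaps-one-interval (len i))))))

      record Triple (e : ℕ) : Set where
        field
          i₁ i₂ i₃ : Fin K
          gapStart≤ : gapStart e ≤ centre i₁
          centre₁<₂ : centre i₁ < centre i₂
          centre₂<₃ : centre i₂ < centre i₃
          <gapStart : centre i₃ < gapStart (suc e)
          ∈X₁ : suc (r i₁) ∈ X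
          ∈X₂ : suc (r i₂) ∈ X
          ∈X₃ : suc (r i₃) ∈ X
          sum≡B : suc (r i₁) + suc (r i₂) + suc (r i₃) ≡ B

      next-after : ∀ {i j ℓ a} → next i ≡ a + ℓ → Starts j (next i) → next j ≡ a + (ℓ + len j)
      next-after {i} {j} {ℓ} {a} next≡ starts = trans (next-Starts starts) (trans (cong (_+ len j) next≡) (+-assoc a ℓ (len j)))

      centre<centre : ∀ {i j} → Starts j (next i) → centre i < centre j
      centre<centre {i} {j} starts = <-≤-trans (s≤s (m≤m+n (centre i) (r i))) (≤-trans (m≤m+n (next i) (r j)) (≤-reflexive (sym starts)))

      in-S-gap : ∀ {e ℓ} → e < n → ℓ < B′ → InGap e (gapStart e + ℓ)
      in-S-gap {e} {ℓ} e<n ℓ<B′ = m≤m+n _ _ , subst (λ g → gapStart e + ℓ < gapStart e + g) (sym (S-gap-length e<n)) (+-monoʳ-< _ ℓ<B′)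

      B′>0 : ∀ {e} → e < n → 0 < B′
      B′>0 {e} e<n = +-cancelʳ-≤ 3 1 B′ (≤-trans (s≤s (s≤s (s≤s (s≤s z≤n)))) (≤-trans (+-mono-≤ 3≤B 3≤B)
                       (≤-reflexive (trans (cong (B +_) (sym (+-identityʳ B))) (sym B′+3≡2B)))))
        where
          3≤B : 3 ≤ B
          3≤B = ≤-trans (s≤s (*-monoʳ-≤ 2 (≤-trans (m<n⇒0<n e<n) (≤-trans (m≤m+n n k) n+k≤m)))) 2m<B

      complete-triple : ∀ {e i₁ i₂ i₃} → e < n →
        Starts i₁ (gapStart e) → Starts i₂ (next i₁) → Starts i₃ (next i₂) → next i₃ ≤ qStart e →
        suc (r i₁) ∈ X → suc (r i₂) ∈ X → suc (r i₃) ∈ X → Triple e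
      complete-triple {e} {i₁} {i₂} {i₃} e<n s₁ s₂ s₃ fits₃ x₁ x₂ x₃ = record
        { i₁ = i₁ ; i₂ = i₂ ; i₃ = i₃
        ; gapStart≤ = ≤-trans (m≤m+n _ (r i₁)) (≤-reflexive (sym s₁))
        ; centre₁<₂ = centre<centre s₂
        ; centre₂<₃ = centre<centre s₃
        ; <gapStart = <-trans (<-≤-trans (s≤s (m≤m+n (centre i₃) (r i₃))) fits₃) (qStart<gapStart e)
        ; ∈X₁ = x₁ ; ∈X₂ = x₂ ; ∈X₃ = x₃
        ; sum≡B = three-lengths≡B′ B′+3≡2B (+-cancelˡ-≡ (gapStart e) (len i₁ + len i₂ + len i₃) B′ (trans (sym n₃) next₃≡q))
        }
        where
          n₃ : next i₃ ≡ gapStart e + (len i₁ + len i₂ + len i₃)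
          n₃ = next-after {ℓ = len i₁ + len i₂} {a = gapStart e} (next-after {ℓ = len i₁} {a = gapStart e} (next-Starts s₁) s₂) s₃
          next₃≡q : next i₃ ≡ gapStart e + B′
          next₃≡q = full (m≤n⇒m<n∨m≡n fits₃)
            where
              full : next i₃ < qStart e ⊎ next i₃ ≡ qStart e → next i₃ ≡ gapStart e + B′
              full (inj₂ next≡q) = trans next≡q (cong (gapStart e +_) (S-gap-length e<n))
              full (inj₁ next<q) = ⊥-elim (four-lengths>B′ B′+3≡2B
                  (proj₁ (bounds x₁)) (proj₁ (bounds x₂)) (proj₁ (bounds x₃)) (proj₁ (bounds (proj₂ (proj₂ (proj₂ fourth)))))
                  (+-cancelˡ-≤ (gapStart e) (len i₁ + len i₂ + len i₃ + len (proj₁ fourth)) B′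
                    (subst₂ _≤_ (next-after {ℓ = len i₁ + len i₂ + len i₃} {a = gapStart e} n₃ (proj₁ (proj₂ fourth)))
                       (cong (gapStart e +_) (S-gap-length e<n)) (proj₁ (proj₂ (proj₂ fourth))))))
                where fourth = S-gap-interval e<n (subst (gapStart e ≤_) (sym n₃) (m≤m+n _ _) , next<q) (inj₂ (i₃ , refl))

      S-gap-triple : ∀ {e} → e < n → Triple e
      S-gap-triple {e} e<n = complete-triple e<n s₁ s₂ s₃ (proj₁ (proj₂ (proj₂ third))) x₁ x₂ (proj₂ (proj₂ (proj₂ third)))
        where
          first = S-gap-interval e<n (subst (InGap e) (+-identityʳ _) (in-S-gap e<n (B′>0 e<n))) (inj₁ refl)
          i₁ = proj₁ first
          s₁ = proj₁ (proj₂ first)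
          x₁ = proj₂ (proj₂ (proj₂ first))
          second = S-gap-interval e<n (subst (InGap e) (sym (next-Starts s₁)) (in-S-gap e<n (one-length<B′ B′+3≡2B (proj₂ (bounds x₁)))))
                     (inj₂ (i₁ , refl))
          i₂ = proj₁ second
          s₂ = proj₁ (proj₂ second)
          x₂ = proj₂ (proj₂ (proj₂ second))
          third = S-gap-interval e<n (subst (InGap e) (sym (next-after {ℓ = len i₁} {a = gapStart e} (next-Starts s₁) s₂))
                    (in-S-gap e<n (two-lengths<B′ B′+3≡2B (proj₂ (bounds x₁)) (proj₂ (bounds x₂))))) (inj₂ (i₂ , refl))
          s₃ = proj₁ (proj₂ third)

      value : Fin K → ℕ
      value i = suc (r i)

      indices : ∀ {e} → Triple e → List (Fin K)
      indices t = i₁ ∷ i₂ ∷ i₃ ∷ [] where open Triple t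

      values : ∀ {e} → Triple e → ℕ × ℕ × ℕ
      values t = value i₁ , value i₂ , value i₃ where open Triple t

      flatten : ℕ × ℕ × ℕ → List ℕ
      flatten t = proj₁ t ∷ proj₁ (proj₂ t) ∷ proj₂ (proj₂ t) ∷ []

      indicesBelow : ∀ j → j ≤ n → List (Fin K)
      indicesBelow zero _ = []
      indicesBelow (suc j) j<n = indicesBelow j (<⇒≤ j<n) ++ indices (S-gap-triple j<n)

      triplesBelow : ∀ j → j ≤ n → List (ℕ × ℕ × ℕ)
      triplesBelow zero _ = []
      triplesBelow (suc j) j<n = triplesBelow j (<⇒≤ j<n) ++ values (S-gap-triple j<n) ∷ []

      flatten-triplesBelow : ∀ j j≤n → concatMap flatten (triplesBelow j j≤n) ≡ map value (indicesBelow j j≤n)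
      flatten-triplesBelow zero _ = refl
      flatten-triplesBelow (suc j) j<n = begin
        concatMap flatten (triplesBelow j _ ++ values t ∷ [])            ≡⟨ concatMap-++ flatten (triplesBelow j _) _ ⟩
        concatMap flatten (triplesBelow j _) ++ flatten (values t) ++ [] ≡⟨ cong (_++ map value (indices t)) (flatten-triplesBelow j _) ⟩
        map value (indicesBelow j _) ++ map value (indices t)           ≡⟨ map-++ value (indicesBelow j _) _ ⟨
        map value (indicesBelow j _ ++ indices t)                       ∎
        where open ≡-Reasoning
              t = S-gap-triple j<n

      length-triplesBelow : ∀ j j≤n → length (triplesBelow j j≤n) ≡ j
      length-triplesBelow zero _ = refl
      length-triplesBelow (suc j) j<n =
        trans (length-++ (triplesBelow j _)) (trans (cong (_+ 1) (length-triplesBelow j _)) (+-comm j 1))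

      length-indicesBelow : ∀ j j≤n → length (indicesBelow j j≤n) ≡ 3 * j
      length-indicesBelow zero _ = refl
      length-indicesBelow (suc j) j<n =
        trans (length-++ (indicesBelow j _)) (trans (cong (_+ 3) (length-indicesBelow j _)) (trans (+-comm (3 * j) 3) (sym (*-suc 3 j))))

      triplesBelow-sum≡B : ∀ j j≤n → All (λ t → proj₁ t + proj₁ (proj₂ t) + proj₂ (proj₂ t) ≡ B) (triplesBelow j j≤n)
      triplesBelow-sum≡B zero _ = All.[]
      triplesBelow-sum≡B (suc j) j<n = All.++⁺ (triplesBelow-sum≡B j _) (Triple.sum≡B (S-gap-triple j<n) All.∷ All.[])

      indicesBelow-∈X : ∀ j j≤n → All (λ i → value i ∈ X) (indicesBelow j j≤n)
      indicesBelow-∈X zero _ = All.[]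
      indicesBelow-∈X (suc j) j<n = All.++⁺ (indicesBelow-∈X j _) (∈X₁ All.∷ ∈X₂ All.∷ ∈X₃ All.∷ All.[])
        where open Triple (S-gap-triple j<n)

      indicesBelow-sorted : ∀ j j≤n →
        AllPairs (λ a b → centre a < centre b) (indicesBelow j j≤n) × All (λ a → centre a < gapStart j) (indicesBelow j j≤n)
      indicesBelow-sorted zero _ = AllPairs.[] , All.[]
      indicesBelow-sorted (suc j) j<n =
        AllPairs.++⁺ sorted (ordered AllPairs.∷ (centre₂<₃ All.∷ All.[]) AllPairs.∷ All.[] AllPairs.∷ AllPairs.[])
                     (All.map before-triple below) ,
        All.++⁺ (All.map (λ c< → <-≤-trans c< st≤) below) (c₁< All.∷ c₂< All.∷ <gapStart All.∷ All.[])
        where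
          open Triple (S-gap-triple j<n)
          sorted = proj₁ (indicesBelow-sorted j (<⇒≤ j<n))
          below = proj₂ (indicesBelow-sorted j (<⇒≤ j<n))
          c₂< = <-trans centre₂<₃ <gapStart
          c₁< = <-trans centre₁<₂ c₂<
          st≤ : gapStart j ≤ gapStart (suc j)
          st≤ = gapStart-mono (n≤1+n j)
          ordered : All (λ b → centre i₁ < centre b) (i₂ ∷ i₃ ∷ [])
          ordered = centre₁<₂ All.∷ <-trans centre₁<₂ centre₂<₃ All.∷ All.[]
          before-triple : ∀ {a} → centre a < gapStart j → All (λ b → centre a < centre b) (i₁ ∷ i₂ ∷ i₃ ∷ [])
          before-triple c< = let c<₁ = <-≤-trans c< gapStart≤ in
            c<₁ All.∷ <-trans c<₁ centre₁<₂ All.∷ <-trans (<-trans c<₁ centre₁<₂) centre₂<₃ All.∷ All.[]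

      partition-into-triples : Unique X → length X ≡ 3 * n →
        Σ (List (ℕ × ℕ × ℕ)) λ T → length T ≡ n
          × All (λ t → proj₁ t + proj₁ (proj₂ t) + proj₂ (proj₂ t) ≡ B) T
          × (concatMap flatten T ↭ X)
      partition-into-triples uX lenX =
        triplesBelow n ≤-refl , length-triplesBelow n ≤-refl , triplesBelow-sum≡B n ≤-refl ,
        subst (_↭ X) (sym (flatten-triplesBelow n ≤-refl)) (Unique-⊆-length⇒↭ _≟_ uVs uX Vs⊆X lenX≤)
        where
          Is = indicesBelow n ≤-refl
          uVs : Unique (map value Is)
          uVs = Unique.map⁺ (λ eq → radius-injective (suc-injective eq))
                  (AllPairs.map (λ c< eq → <-irrefl (cong centre eq) c<) (proj₁ (indicesBelow-sorted n ≤-refl)))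
          Vs⊆X : ∀ {x} → x ∈ map value Is → x ∈ X
          Vs⊆X x∈ with ∈-map⁻ value x∈
          ... | i , i∈ , refl = All.lookup (indicesBelow-∈X n ≤-refl) i∈
          lenX≤ : length X ≤ length (map value Is)
          lenX≤ = ≤-reflexive (trans lenX (sym (trans (length-map value Is) (length-indicesBelow n ≤-refl))))

-- The graph G_p

module GpProperties (n B : ℕ) .{{_ : NonZero n}} (X : List ℕ) (uniqueX : Unique X) (lengthX : length X ≡ 3 * n)
  (sumX : sum X ≡ n * B) (boundsX : All (λ a → B < 4 * a × 2 * a < B) X) where

  m = maxList X
  K = 2 * m + 1
  Y = Ylist X
  k = m ∸ 3 * n
  U = downFrom m

  bounds : ∀ {a} → a ∈ X → B < 4 * a × 2 * a < B
  bounds = All.lookup boundsX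

  ∈X⇒>0 : ∀ {a} → a ∈ X → 0 < a
  ∈X⇒>0 {zero} a∈ with proj₁ (bounds a∈)
  ... | ()
  ∈X⇒>0 {suc a} _ = z<s

  m∈X : m ∈ X
  m∈X = nonempty X lengthX
    where
      nonempty : ∀ xs → length xs ≡ 3 * n → maxList xs ∈ xs
      nonempty (x ∷ xs) _ = maxList∈ x xs
      nonempty [] 0≡3n = ⊥-elim (<-irrefl 0≡3n (<-≤-trans (>-nonZero⁻¹ n) (m≤n*m n 3)))

  2m<B : 2 * m < B
  2m<B = proj₂ (bounds m∈X)

  inX? : U.Decidable (λ j → suc j ∈ X)
  inX? j = suc j ∈? X

  X↭ : map suc (filter inX? U) ↭ X
  X↭ = Unique-⊆-⊇⇒↭ (Unique.map⁺ suc-injective (Unique.filter⁺ inX? (Unique.downFrom⁺ m))) uniqueX ⊆X X⊆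
    where
      ⊆X : ∀ {x} → x ∈ map suc (filter inX? U) → x ∈ X
      ⊆X x∈ with ∈-map⁻ suc x∈
      ... | j , j∈ , refl = proj₂ (∈-filter⁻ inX? {xs = U} j∈)
      X⊆ : ∀ {x} → x ∈ X → x ∈ map suc (filter inX? U)
      X⊆ {zero} x∈ = ⊥-elim (<-irrefl refl (∈X⇒>0 x∈))
      X⊆ {suc j} x∈ = ∈-map⁺ suc (∈-filter⁺ inX? (∈-downFrom⁺ (∈⇒≤maxList x∈)) x∈)

  length-Y+3n : 3 * n + length Y ≡ m
  length-Y+3n = begin
    3 * n + length Y                                        ≡⟨ cong₂ _+_ (trans (sym lengthX) (sym (↭.↭-length X↭))) (length-map _ (filter (∁? inX?) U)) ⟩
    length (map suc (filter inX? U)) + length (filter (∁? inX?) U) ≡⟨ cong (_+ length (filter (∁? inX?) U)) (length-map suc (filter inX? U)) ⟩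
    length (filter inX? U) + length (filter (∁? inX?) U)   ≡⟨ length-++ (filter inX? U) ⟨
    length (filter inX? U ++ filter (∁? inX?) U)            ≡⟨ ↭.↭-length (filter++filter∁↭ inX? U) ⟩
    length U                                                ≡⟨ length-downFrom m ⟩
    m                                                       ∎
    where open ≡-Reasoning

  3n≤m : 3 * n ≤ m
  3n≤m = subst (3 * n ≤_) length-Y+3n (m≤m+n (3 * n) (length Y))

  length-Y : length Y ≡ k
  length-Y = trans (sym (m+n∸m≡n (3 * n) (length Y))) (cong (_∸ 3 * n) length-Y+3n)

  n+k≤m : n + k ≤ m
  n+k≤m = subst (n + k ≤_) (m+[n∸m]≡n 3n≤m) (+-monoˡ-≤ k (m≤n*m n 3))

  private
    odd : ℕ → ℕ
    odd a = 2 * a ∸ 1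

    Σodd+length : ∀ xs → (∀ {a} → a ∈ xs → 0 < a) → sum (map odd xs) + length xs ≡ 2 * sum xs
    Σodd+length [] _ = refl
    Σodd+length (a ∷ xs) pos = begin
      odd a + sum (map odd xs) + suc (length xs)   ≡⟨ eq (odd a) (sum (map odd xs)) (length xs) ⟩
      odd a + 1 + (sum (map odd xs) + length xs)   ≡⟨ cong₂ _+_ (m∸n+n≡m (≤-trans (pos (here refl)) (m≤m+n a (a + 0))))
                                                                (Σodd+length xs (λ a∈ → pos (there a∈))) ⟩
      2 * a + 2 * sum xs                           ≡⟨ *-distribˡ-+ 2 a (sum xs) ⟨
      2 * (a + sum xs)                             ∎
      where open ≡-Reasoning
            eq : ∀ x y z → x + y + suc z ≡ x + 1 + (y + z)
            eq = solve-∀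

  ΣoddX≡ : sum (map odd X) ≡ n * (2 * B ∸ 3)
  ΣoddX≡ = begin
    sum (map odd X)                       ≡⟨ m+n∸n≡m (sum (map odd X)) (3 * n) ⟨
    sum (map odd X) + 3 * n ∸ 3 * n       ≡⟨ cong (λ l → sum (map odd X) + l ∸ 3 * n) lengthX ⟨
    sum (map odd X) + length X ∸ 3 * n    ≡⟨ cong (_∸ 3 * n) (Σodd+length X ∈X⇒>0) ⟩
    2 * sum X ∸ 3 * n                     ≡⟨ cong (λ s → 2 * s ∸ 3 * n) sumX ⟩
    2 * (n * B) ∸ 3 * n                   ≡⟨ cong₂ _∸_ (eq n B) (*-comm 3 n) ⟩
    n * (2 * B) ∸ n * 3                   ≡⟨ *-distribˡ-∸ n (2 * B) 3 ⟨
    n * (2 * B ∸ 3)                       ∎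
    where open ≡-Reasoning
          eq : ∀ n B → 2 * (n * B) ≡ n * (2 * B)
          eq = solve-∀

  B′≡2B-3 : B′ n X ≡ 2 * B ∸ 3
  B′≡2B-3 = trans (cong (_/ n) (trans ΣoddX≡ (*-comm n _))) (m*n/n≡m (2 * B ∸ 3) n)

  B′+3≡2B : B′ n X + 3 ≡ 2 * B
  B′+3≡2B = trans (cong (_+ 3) B′≡2B-3) (m∸n+n≡m (≤-trans 3≤B (m≤m+n B (B + 0))))
    where
      3≤B : 3 ≤ B
      3≤B = ≤-trans (s≤s (*-monoʳ-≤ 2 (∈X⇒>0 m∈X))) 2m<B

  n*B′+ΣY≡m² : n * B′ n X + sum Y ≡ m * m
  n*B′+ΣY≡m² = begin
    n * B′ n X + sum Y                                   ≡⟨ cong (_+ sum Y) (trans (cong (n *_) B′≡2B-3) (sym ΣoddX≡)) ⟩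
    sum (map odd X) + sum Y                              ≡⟨ cong (_+ sum Y) (sum-↭ (↭.map⁺ odd X↭)) ⟨
    sum (map odd (map suc (filter inX? U))) + sum Y      ≡⟨ cong (λ l → sum l + sum Y) (map-∘ {g = odd} {f = suc} (filter inX? U)) ⟨
    sum (map (λ j → 2 * suc j ∸ 1) (filter inX? U)) + sum Y ≡⟨ sum-++ (map _ (filter inX? U)) (map _ (filter (∁? inX?) U)) ⟨
    sum (map (λ j → 2 * suc j ∸ 1) (filter inX? U) ++ Y) ≡⟨ cong sum (map-++ _ (filter inX? U) (filter (∁? inX?) U)) ⟨
    sum (map (λ j → 2 * suc j ∸ 1) (filter inX? U ++ filter (∁? inX?) U)) ≡⟨ sum-↭ (↭.map⁺ _ (filter++filter∁↭ inX? U)) ⟩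
    sum (map (λ j → 2 * suc j ∸ 1) U)                    ≡⟨ Σ-odd m ⟩
    m * m                                                ∎
    where open ≡-Reasoning

  Y-odd : ∀ {y} → y ∈ Y → ∃ λ t → y ≡ 2 * t + 1 × t < m × suc t ∉ X
  Y-odd y∈ with ∈-map⁻ (λ j → 2 * suc j ∸ 1) y∈
  ... | t , t∈ , refl = t , 2*[1+n]∸1≡2*n+1 t , ∈-downFrom⁻ (proj₁ t∈U×t∉X) , proj₂ t∈U×t∉X
    where t∈U×t∉X = ∈-filter⁻ (∁? inX?) {xs = U} t∈

  odd∈Y : ∀ {t} → t < m → suc t ∉ X → 2 * t + 1 ∈ Y
  odd∈Y {t} t<m t∉X = subst (_∈ Y) (2*[1+n]∸1≡2*n+1 t)
                        (∈-map⁺ (λ j → 2 * suc j ∸ 1) (∈-filter⁺ (∁? inX?) (∈-downFrom⁺ t<m) t∉X))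

  -- the path just before Q_{e+1}: S_{e+1} for e < n, S′_{e+1-n} for n ≤ e < n + k, and none after
  gapSegment : ℕ → List (ℕ × Bool)
  gapSegment e with e <? n | e <? n + k
  ... | yes _ | _ = (B′ n X , false) ∷ []
  ... | no _ | yes _ = (nth Y (e ∸ n) , false) ∷ []
  ... | no _ | no _ = []

  gapSegment-S : ∀ {e} → e < n → gapSegment e ≡ (B′ n X , false) ∷ []
  gapSegment-S {e} e<n with e <? n
  ... | yes _ = refl
  ... | no e≮n = ⊥-elim (e≮n e<n)

  gapSegment-S′ : ∀ {e} → n ≤ e → e < n + k → gapSegment e ≡ (nth Y (e ∸ n) , false) ∷ []
  gapSegment-S′ {e} n≤e e<n+k with e <? n | e <? n + k
  ... | yes e<n | _ = ⊥-elim (<⇒≱ e<n n≤e)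
  ... | no _ | yes _ = refl
  ... | no _ | no e≮n+k = ⊥-elim (e≮n+k e<n+k)

  gapSegment-none : ∀ {e} → n + k ≤ e → gapSegment e ≡ []
  gapSegment-none {e} n+k≤e with e <? n | e <? n + k
  ... | yes e<n | _ = ⊥-elim (<⇒≱ (<-≤-trans e<n (m≤m+n n k)) n+k≤e)
  ... | no _ | yes e<n+k = ⊥-elim (<⇒≱ e<n+k n+k≤e)
  ... | no _ | no _ = refl

  open SegmentBlocks K gapSegment public
  open Blocks K gap public

  S-blocks : concatMap (λ i → (B′ n X , false) ∷ (qlen m i , true) ∷ []) (range 1 (suc n)) ≡ blocksFrom 0 n
  S-blocks = trans (cong (concatMap _) (map-upTo (1 +_) n))
    (concatMap-applyUpTo _ (1 +_) 0 n (λ i i<n → cong (_++ (2 * R i + 1 , true) ∷ []) (sym (gapSegment-S i<n))))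

  S′-blocks : concatMap (λ p → (proj₁ p , false) ∷ (qlen m (n + suc (proj₂ p)) , true) ∷ []) (zip Y (upTo (length Y)))
            ≡ blocksFrom n k
  S′-blocks = trans (concatMap-zip-applyUpTo _ (λ i → i) n Y λ i i<Y → sym (begin
      gapSegment (n + i) ++ (2 * R (n + i) + 1 , true) ∷ []
        ≡⟨ cong (_++ (2 * R (n + i) + 1 , true) ∷ []) (gapSegment-S′ (m≤m+n n i) (+-monoʳ-< n (subst (i <_) length-Y i<Y))) ⟩
      (nth Y (n + i ∸ n) , false) ∷ (2 * R (n + i) + 1 , true) ∷ []
        ≡⟨ cong₂ (λ y j → (nth Y y , false) ∷ (qlen m j , true) ∷ []) (m+n∸m≡n n i) (sym (+-suc n i)) ⟩
      (nth Y i , false) ∷ (qlen m (n + suc i) , true) ∷ [] ∎))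
    (cong (blocksFrom n) length-Y)
    where open ≡-Reasoning

  Q-tail-blocks : map (λ j → (qlen m j , true)) (range (n + k + 1) (m + 2)) ≡ blocksFrom (n + k) (m + 2 ∸ (n + k + 1))
  Q-tail-blocks = begin
    map h (map (n + k + 1 +_) (upTo c))       ≡⟨ cong (map h) (map-upTo (n + k + 1 +_) c) ⟩
    map h (applyUpTo (n + k + 1 +_) c)        ≡⟨ concatMap-pure (map h (applyUpTo (n + k + 1 +_) c)) ⟨
    concatMap [_] (map h (applyUpTo (n + k + 1 +_) c)) ≡⟨ concatMap-map [_] h (applyUpTo (n + k + 1 +_) c) ⟩
    concatMap (λ j → h j ∷ []) (applyUpTo (n + k + 1 +_) c)
      ≡⟨ concatMap-applyUpTo (λ j → h j ∷ []) (n + k + 1 +_) (n + k) c (λ i _ → sym (begin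
           gapSegment (n + k + i) ++ (2 * R (n + k + i) + 1 , true) ∷ []
             ≡⟨ cong (_++ (2 * R (n + k + i) + 1 , true) ∷ []) (gapSegment-none (m≤m+n (n + k) i)) ⟩
           (qlen m (suc (n + k + i)) , true) ∷ []
             ≡⟨ cong (λ j → (qlen m j , true) ∷ []) (eq (n + k) i) ⟩
           (qlen m (n + k + 1 + i) , true) ∷ [] ∎)) ⟩
    blocksFrom (n + k) c ∎
    where
      open ≡-Reasoning
      h = λ j → (qlen m j , true)
      c = m + 2 ∸ (n + k + 1)
      eq : ∀ a i → suc (a + i) ≡ a + 1 + i
      eq = solve-∀

  trailing : ℕ
  trailing = m + 2 ∸ (n + k + 1)

  n+k+trailing≡1+m : n + (k + trailing) ≡ suc m
  n+k+trailing≡1+m = +-cancelʳ-≡ 1 (n + (k + trailing)) (suc m)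
                       (trans (eq n k trailing) (trans (m∸n+n≡m (+-mono-≤ n+k≤m (s≤s (z≤n {1})))) (eq′ m)))
    where eq : ∀ a b c → a + (b + c) + 1 ≡ c + (a + b + 1)
          eq = solve-∀
          eq′ : ∀ m → m + 2 ≡ suc m + 1
          eq′ = solve-∀

  segments≡blocks : segments n X ≡ blocksFrom 0 (suc m)
  segments≡blocks = begin
    segments n X                                                     ≡⟨ cong₂ _++_ S-blocks (cong₂ _++_ S′-blocks Q-tail-blocks) ⟩
    blocksFrom 0 n ++ blocksFrom n k ++ blocksFrom (n + k) trailing  ≡⟨ cong (blocksFrom 0 n ++_) (blocksFrom-+ n k trailing) ⟨
    blocksFrom 0 n ++ blocksFrom n (k + trailing)                    ≡⟨ blocksFrom-+ 0 n (k + trailing) ⟨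
    blocksFrom 0 (n + (k + trailing))                                ≡⟨ cong (blocksFrom 0) n+k+trailing≡1+m ⟩
    blocksFrom 0 (suc m)                                             ∎
    where open ≡-Reasoning

  S-gap-length : ∀ {e} → e < n → gap e ≡ B′ n X
  S-gap-length e<n = trans (cong pathLen (gapSegment-S e<n)) (+-identityʳ _)

  S′-gap-nth : ∀ {i} → i < k → gap (n + i) ≡ nth Y i
  S′-gap-nth {i} i<k = trans (cong pathLen (gapSegment-S′ (m≤m+n n i) (+-monoʳ-< n i<k)))
                       (trans (+-identityʳ _) (cong (nth Y) (m+n∸m≡n n i)))

  S′-gap-length : ∀ {e} → n ≤ e × e < n + k → ∃ λ t → gap e ≡ 2 * t + 1 × t < m × suc t ∉ X
  S′-gap-length {e} (n≤e , e<n+k) = t , trans (subst (λ x → gap x ≡ nth Y (e ∸ n)) (m+[n∸m]≡n n≤e) (S′-gap-nth i<k)) y≡ , t<m , t∉X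
    where
      i<k : e ∸ n < k
      i<k = +-cancelˡ-< n (e ∸ n) k (subst (_< n + k) (sym (m+[n∸m]≡n n≤e)) e<n+k)
      y∈ = Y-odd (nth-∈ Y (subst (e ∸ n <_) (sym length-Y) i<k))
      t = proj₁ y∈
      y≡ = proj₁ (proj₂ y∈)
      t<m = proj₁ (proj₂ (proj₂ y∈))
      t∉X = proj₂ (proj₂ (proj₂ y∈))

  S′-gap-for : ∀ {t} → t < m → suc t ∉ X → ∃ λ e → (n ≤ e × e < n + k) × gap e ≡ 2 * t + 1
  S′-gap-for t<m t∉X with ∈⇒nth (odd∈Y t<m t∉X)
  ... | i , i<Y , nth≡ = n + i , (m≤m+n n i , +-monoʳ-< n i<k) , trans (S′-gap-nth i<k) nth≡
    where i<k = subst (_ <_) length-Y i<Y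

  Σgap≡m² : Σ< (suc m) gap ≡ m * m
  Σgap≡m² = begin
    Σ< (suc m) gap                                           ≡⟨ cong (λ c → Σ< c gap) n+k+trailing≡1+m ⟨
    Σ< (n + (k + trailing)) gap                              ≡⟨ Σ<-+ n (k + trailing) gap ⟩
    Σ< n gap + Σ< (k + trailing) (λ i → gap (n + i))         ≡⟨ cong (Σ< n gap +_) (Σ<-+ k trailing (λ i → gap (n + i))) ⟩
    Σ< n gap + (Σ< k (λ i → gap (n + i)) + Σ< trailing (λ i → gap (n + (k + i))))
      ≡⟨ cong₂ (λ a b → a + (b + Σ< trailing (λ i → gap (n + (k + i))))) S-total S′-total ⟩
    n * B′ n X + (sum Y + Σ< trailing (λ i → gap (n + (k + i)))) ≡⟨ cong (λ z → n * B′ n X + (sum Y + z)) tail-total ⟩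
    n * B′ n X + (sum Y + 0)                                 ≡⟨ cong (n * B′ n X +_) (+-identityʳ (sum Y)) ⟩
    n * B′ n X + sum Y                                       ≡⟨ n*B′+ΣY≡m² ⟩
    m * m                                                    ∎
    where
      open ≡-Reasoning
      S-total : Σ< n gap ≡ n * B′ n X
      S-total = trans (Σ<-cong n (λ i i<n → S-gap-length i<n)) (Σ<-const n (B′ n X))
      S′-total : Σ< k (λ i → gap (n + i)) ≡ sum Y
      S′-total = trans (Σ<-cong k (λ i i<k → S′-gap-nth i<k)) (trans (cong (λ c → Σ< c (nth Y)) (sym length-Y)) (Σ<-nth Y))
      tail-total : Σ< trailing (λ i → gap (n + (k + i))) ≡ 0
      tail-total = trans (Σ<-cong trailing (λ i _ → cong pathLen (gapSegment-none (≤-trans (m≤m+n (n + k) i) (≤-reflexive (+-assoc n k i))))))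
                     (trans (Σ<-const trailing 0) (*-zeroʳ trailing))


  total : gapStart (suc m) ≡ K * K
  total = begin
    gapStart (suc m)                                         ≡⟨ gapStart≡Σ (suc m) ⟩
    Σ< (suc m) gap + Σ< (suc m) (λ j → 2 * R j + 1)          ≡⟨ cong (_+ Σ< (suc m) (λ j → 2 * R j + 1)) Σgap≡m² ⟩
    m * m + Σ< (suc m) (λ j → 2 * R j + 1)                   ≡⟨ +-comm (m * m) _ ⟩
    Σ< (suc m) (λ j → 2 * R j + 1) + m * m                   ≡⟨ cong (λ x → Σ< (suc m) (λ j → 2 * R j + 1) + x * x) K∸[1+m]≡m ⟨
    Σ< (suc m) (λ j → 2 * R j + 1) + (K ∸ suc m) * (K ∸ suc m) ≡⟨ Σ-Q+square (suc m) (subst (suc m ≤_) (sym K≡) (m≤m+n (suc m) m)) ⟩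
    K * K                                                    ∎
    where
      open ≡-Reasoning
      K≡ : K ≡ suc m + m
      K≡ = eq m
        where eq : ∀ m → 2 * m + 1 ≡ suc m + m
              eq = solve-∀
      K∸[1+m]≡m : K ∸ suc m ≡ m
      K∸[1+m]≡m = trans (cong (_∸ suc m) K≡) (m+n∸m≡n (suc m) m)

  pathLen-segments : pathLen (segments n X) ≡ K * K
  pathLen-segments = trans (cong pathLen segments≡blocks) (trans (pathLen-blocksFrom (suc m)) total)

  Q-in-segments : ∀ {e} → e ≤ m → ∃₂ λ pre post →
    segments n X ≡ pre ++ (qlen m (suc e) , true) ∷ post × pathLen pre ≡ qStart e
  Q-in-segments e≤m with Q-in-blocks (s≤s e≤m)
  ... | pre , post , split , length≡ = pre , post , trans segments≡blocks split , length≡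

  module _ {bs : Vec (Fin (N (Gp n X))) K} (burns : IsBurningSequence (Gp n X) K bs) where

    private
      g : Fin K → ℕ
      g i = height (segments n X) (lookup bs i)

      module Cover = BallCover K g
        (λ p p< → burning-near-path (segments n X) {K} {bs} burns (subst (p <_) (sym pathLen-segments) p<))

    burned-partition : IntervalPartition K
    burned-partition = Cover.partition

    open IntervalPartition burned-partition

    -- the vertex added between two consecutive vertices of Q_{e+1} puts both in one interval
    Q-linked : ∀ e → e ≤ m → ∀ x → suc x < 2 * R e + 1 →
      ∃ λ i → Near (radius K i) (centre i) (qStart e + x) × Near (radius K i) (centre i) (qStart e + suc x)
    Q-linked e e≤m x 1+x< =
      i , Near-sym (proj₁ both) ,
      Near-sym (subst (λ p → Near (radius K i) p (centre i)) (sym (+-suc (qStart e) x)) (proj₂ both))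
      where
        Q = Q-in-segments e≤m
        burnt = burning-near-extra (segments n X) {K} {bs} burns
                  (proj₁ Q) (2 * R e + 1) (proj₁ (proj₂ Q)) (proj₁ (proj₂ (proj₂ Q))) 1+x<
        i = proj₁ burnt
        both = Near-odd-double (subst₂ (λ p c → Near (2 * radius K i) (2 * (p + x) + 1) c)
                 (proj₂ (proj₂ (proj₂ Q))) (Cover.g≡2*centre i) (proj₂ burnt))

lemma4 : (n B : ℕ) → .{{_ : NonZero n}} → (X : List ℕ) →
    Unique X → length X ≡ 3 * n → sum X ≡ n * B →
    All (λ a → B < 4 * a × 2 * a < B) X →
    BurningNumberIs (Gp n X) (2 * maxList X + 1) →
    Σ (List (ℕ × ℕ × ℕ)) λ T →
      length T ≡ n
      × All (λ t → Data.Product.proj₁ t + Data.Product.proj₁ (Data.Product.proj₂ t) + Data.Product.proj₂ (Data.Product.proj₂ t) ≡ B) T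
      × (concatMap (λ t → Data.Product.proj₁ t ∷ Data.Product.proj₁ (Data.Product.proj₂ t) ∷ Data.Product.proj₂ (Data.Product.proj₂ t) ∷ []) T ↭ X)
lemma4 n B X uniqueX lengthX sumX boundsX ((bs , burns) , _) = partition-into-triples uniqueX lengthX
  where
    open GpProperties n B X uniqueX lengthX sumX boundsX
      using (m; k; gap; total; bounds; 2m<B; B′+3≡2B; n+k≤m; S-gap-length; S′-gap-length; S′-gap-for; burned-partition; Q-linked)
    open Positions.Gaps m (burned-partition {bs} burns) gap total (Q-linked {bs} burns)
      X B (B′ n X) n k bounds 2m<B B′+3≡2B n+k≤m S-gap-length S′-gap-length S′-gap-for
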